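{- Let $\phi(0,S)$ be a second-order sentence in the vocabulary $\{0,S\}$. Then the theory $$\{\mathbf{PA}_1^{2(N_1)},\ \mathbf{PA}_2^{2(N_2)},\ \phi^{(N_1)}(0_1,S_1),\ \neg\phi^{(N_2)}(0_2,S_2)\}$$ is deductively inconsistent in second-order logic.
   Context: $\mathrm{PA}^2$ is second-order Peano arithmetic in vocabulary $\{0,S\}$ ($0$ constant, $S$ unary function). For $j=1,2$, $N_j$ is a unary predicate symbol, $0_j$ a constant and $S_j$ a unary function symbol; $\phi^{(N_j)}(0_j,S_j)$ is $\phi$ with $0,S$ replaced by $0_j,S_j$ and all first- and second-order quantifiers relativized to $N_j$; $\mathbf{PA}^{2(N_j)}_j$ is the conjunction of all $\phi^{(N_j)}(0_j,S_j)$ for $\phi\in\mathrm{PA}^2$ together with $N_j(0_j)$ and $\forall x(N_j(x)\to N_j(S_j(x)))$. Deductive inconsistency is with respect to the usual deductive system of second-order logic (first-order axioms, introduction/elimination rules for second-order quantifiers, all instances of comprehension and choice). -}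

module Defs where

open import Data.Nat using (ℕ; zero; suc; _+_)
open import Data.Fin using (Fin; zero; suc; _↑ˡ_; _↑ʳ_)
open import Data.Vec using (Vec; []; _∷_; map; tabulate; _++_; foldr)
open import Data.List using (List; []; _∷_)
open import Data.List.Membership.Propositional using (_∈_)
open import Data.Unit using (⊤; tt)
open import Data.Empty using (⊥)
import Data.List as List

record Signature : Set₁ where
  field
    Const : Set
    Fun1  : Set
    Pred1 : Set
open Signature public

-- Syntax of second-order logic with equality.
-- First-order variables: de Bruijn indices in Fin n.
-- Second-order (relation) variables: de Bruijn indices into a context
-- Δ : List ℕ of arities.

data SVar : List ℕ → ℕ → Set where
  here  : ∀ {k Δ} → SVar (k ∷ Δ) k
  there : ∀ {k j Δ} → SVar Δ k → SVar (j ∷ Δ) k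

data Term (L : Signature) (n : ℕ) : Set where
  var : Fin n → Term L n
  con : Const L → Term L n
  app : Fun1 L → Term L n → Term L n

infixr 6 _∧'_
infixr 5 _∨'_
infixr 4 _⇒_
infix 7 _≐_

data Formula (L : Signature) : ℕ → List ℕ → Set where
  _≐_  : ∀ {n Δ} → Term L n → Term L n → Formula L n Δ
  prd  : ∀ {n Δ} → Pred1 L → Term L n → Formula L n Δ
  sapp : ∀ {n Δ k} → SVar Δ k → Vec (Term L n) k → Formula L n Δ
  ⊥'   : ∀ {n Δ} → Formula L n Δ
  _⇒_  : ∀ {n Δ} → Formula L n Δ → Formula L n Δ → Formula L n Δ
  _∧'_ : ∀ {n Δ} → Formula L n Δ → Formula L n Δ → Formula L n Δ
  _∨'_ : ∀ {n Δ} → Formula L n Δ → Formula L n Δ → Formula L n Δ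
  ∀'   : ∀ {n Δ} → Formula L (suc n) Δ → Formula L n Δ
  ∃'   : ∀ {n Δ} → Formula L (suc n) Δ → Formula L n Δ
  ∀²   : ∀ {n Δ} (k : ℕ) → Formula L n (k ∷ Δ) → Formula L n Δ
  ∃²   : ∀ {n Δ} (k : ℕ) → Formula L n (k ∷ Δ) → Formula L n Δ

module _ {L : Signature} where

  ¬' : ∀ {n Δ} → Formula L n Δ → Formula L n Δ
  ¬' φ = φ ⇒ ⊥'

  ⊤' : ∀ {n Δ} → Formula L n Δ
  ⊤' = ⊥' ⇒ ⊥'

  _⇔_ : ∀ {n Δ} → Formula L n Δ → Formula L n Δ → Formula L n Δ
  φ ⇔ ψ = (φ ⇒ ψ) ∧' (ψ ⇒ φ)

  ⋀ : ∀ {n Δ k} → Vec (Formula L n Δ) k → Formula L n Δ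
  ⋀ [] = ⊤'
  ⋀ (φ ∷ φs) = φ ∧' ⋀ φs

  ∀ⁿ : ∀ {n Δ} (k : ℕ) → Formula L (k + n) Δ → Formula L n Δ
  ∀ⁿ zero φ = φ
  ∀ⁿ (suc k) φ = ∀ⁿ k (∀' φ)

  vars : (k n : ℕ) → Vec (Term L (k + n)) k
  vars k n = tabulate (λ i → var (i ↑ˡ n))

  substT : ∀ {n m} → Term L n → (Fin n → Term L m) → Term L m
  substT (var i) σ = σ i
  substT (con c) σ = con c
  substT (app f t) σ = app f (substT t σ)

  wkT : ∀ {n} → Term L n → Term L (suc n)
  wkT t = substT t (λ i → var (suc i))

  liftσ : ∀ {n m} → (Fin n → Term L m) → Fin (suc n) → Term L (suc m)
  liftσ σ zero = var zero
  liftσ σ (suc i) = wkT (σ i)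

  substF : ∀ {n m Δ} → Formula L n Δ → (Fin n → Term L m) → Formula L m Δ
  substF (t ≐ s) σ = substT t σ ≐ substT s σ
  substF (prd P t) σ = prd P (substT t σ)
  substF (sapp X ts) σ = sapp X (map (λ t → substT t σ) ts)
  substF ⊥' σ = ⊥'
  substF (φ ⇒ ψ) σ = substF φ σ ⇒ substF ψ σ
  substF (φ ∧' ψ) σ = substF φ σ ∧' substF ψ σ
  substF (φ ∨' ψ) σ = substF φ σ ∨' substF ψ σ
  substF (∀' φ) σ = ∀' (substF φ (liftσ σ))
  substF (∃' φ) σ = ∃' (substF φ (liftσ σ))
  substF (∀² k φ) σ = ∀² k (substF φ σ)
  substF (∃² k φ) σ = ∃² k (substF φ σ)

  wkF : ∀ {n Δ} → Formula L n Δ → Formula L (suc n) Δ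
  wkF φ = substF φ (λ i → var (suc i))

  inst : ∀ {n Δ} → Formula L (suc n) Δ → Term L n → Formula L n Δ
  inst φ t = substF φ σ
    where
      σ : _ → _
      σ zero = t
      σ (suc i) = var i

  SRen : List ℕ → List ℕ → Set
  SRen Δ Δ' = ∀ {k} → SVar Δ k → SVar Δ' k

  liftρ : ∀ {Δ Δ' j} → SRen Δ Δ' → SRen (j ∷ Δ) (j ∷ Δ')
  liftρ ρ here = here
  liftρ ρ (there v) = there (ρ v)

  renS : ∀ {n Δ Δ'} → Formula L n Δ → SRen Δ Δ' → Formula L n Δ'
  renS (t ≐ s) ρ = t ≐ s
  renS (prd P t) ρ = prd P t
  renS (sapp X ts) ρ = sapp (ρ X) ts
  renS ⊥' ρ = ⊥'
  renS (φ ⇒ ψ) ρ = renS φ ρ ⇒ renS ψ ρ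
  renS (φ ∧' ψ) ρ = renS φ ρ ∧' renS ψ ρ
  renS (φ ∨' ψ) ρ = renS φ ρ ∨' renS ψ ρ
  renS (∀' φ) ρ = ∀' (renS φ ρ)
  renS (∃' φ) ρ = ∃' (renS φ ρ)
  renS (∀² k φ) ρ = ∀² k (renS φ (liftρ ρ))
  renS (∃² k φ) ρ = ∃² k (renS φ (liftρ ρ))

  wkS : ∀ {n Δ j} → Formula L n Δ → Formula L n (j ∷ Δ)
  wkS φ = renS φ there

  instS : ∀ {n Δ k} → Formula L n (k ∷ Δ) → SVar Δ k → Formula L n Δ
  instS {k = k} φ Y = renS φ ρ
    where
      ρ : SRen (k ∷ _) _
      ρ here = Y
      ρ (there v) = v

  Comprehension : ∀ {n Δ} (k : ℕ) → Formula L (k + n) Δ → Formula L n Δ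
  Comprehension {n} k ψ = ∃² k (∀ⁿ k (sapp here (vars k n) ⇔ wkS ψ))

  -- Choice: ∀x̄ ∃X φ(x̄,X) → ∃Y ∀x̄ ∃X (∀ȳ (X ȳ ↔ Y x̄ ȳ) ∧ φ(x̄,X)),
  -- i.e. ∀x̄ ∃X φ(x̄,X) → ∃Y ∀x̄ φ(x̄,Y_x̄), with Y_x̄ = {ȳ : Y x̄ ȳ}.
  Choice : ∀ {n Δ} (k m : ℕ) → Formula L (k + n) (m ∷ Δ) → Formula L n Δ
  Choice {n} {Δ} k m φ =
    ∀ⁿ k (∃² m φ)
      ⇒ ∃² (k + m) (∀ⁿ k (∃² m
           (∀ⁿ m (sapp here ys ⇔ sapp (there here) (xs ++ ys))
             ∧' renS φ ρ)))
    where
      ys : Vec (Term L (m + (k + n))) m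
      ys = tabulate (λ i → var (i ↑ˡ (k + n)))
      xs : Vec (Term L (m + (k + n))) k
      xs = tabulate (λ i → var (m ↑ʳ (i ↑ˡ n)))
      ρ : SRen (m ∷ Δ) (m ∷ (k + m) ∷ Δ)
      ρ here = here
      ρ (there v) = there (there v)

infix 2 _⊢_

data _⊢_ {L : Signature} : ∀ {n Δ} → List (Formula L n Δ) → Formula L n Δ → Set where
  assume : ∀ {n Δ} {Γ : List (Formula L n Δ)} {φ} → φ ∈ Γ → Γ ⊢ φ
  ⊥E     : ∀ {n Δ} {Γ : List (Formula L n Δ)} {φ} → Γ ⊢ ⊥' → Γ ⊢ φ
  raa    : ∀ {n Δ} {Γ : List (Formula L n Δ)} {φ} → (¬' φ ∷ Γ) ⊢ ⊥' → Γ ⊢ φ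
  ⇒I     : ∀ {n Δ} {Γ : List (Formula L n Δ)} {φ ψ} → (φ ∷ Γ) ⊢ ψ → Γ ⊢ φ ⇒ ψ
  ⇒E     : ∀ {n Δ} {Γ : List (Formula L n Δ)} {φ ψ} → Γ ⊢ φ ⇒ ψ → Γ ⊢ φ → Γ ⊢ ψ
  ∧I     : ∀ {n Δ} {Γ : List (Formula L n Δ)} {φ ψ} → Γ ⊢ φ → Γ ⊢ ψ → Γ ⊢ φ ∧' ψ
  ∧E₁    : ∀ {n Δ} {Γ : List (Formula L n Δ)} {φ ψ} → Γ ⊢ φ ∧' ψ → Γ ⊢ φ
  ∧E₂    : ∀ {n Δ} {Γ : List (Formula L n Δ)} {φ ψ} → Γ ⊢ φ ∧' ψ → Γ ⊢ ψ
  ∨I₁    : ∀ {n Δ} {Γ : List (Formula L n Δ)} {φ ψ} → Γ ⊢ φ → Γ ⊢ φ ∨' ψ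
  ∨I₂    : ∀ {n Δ} {Γ : List (Formula L n Δ)} {φ ψ} → Γ ⊢ ψ → Γ ⊢ φ ∨' ψ
  ∨E     : ∀ {n Δ} {Γ : List (Formula L n Δ)} {φ ψ χ} →
           Γ ⊢ φ ∨' ψ → (φ ∷ Γ) ⊢ χ → (ψ ∷ Γ) ⊢ χ → Γ ⊢ χ
  ∀I     : ∀ {n Δ} {Γ : List (Formula L n Δ)} {φ} → List.map wkF Γ ⊢ φ → Γ ⊢ ∀' φ
  ∀E     : ∀ {n Δ} {Γ : List (Formula L n Δ)} {φ} → Γ ⊢ ∀' φ → (t : Term L n) → Γ ⊢ inst φ t
  ∃I     : ∀ {n Δ} {Γ : List (Formula L n Δ)} {φ} (t : Term L n) → Γ ⊢ inst φ t → Γ ⊢ ∃' φ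
  ∃E     : ∀ {n Δ} {Γ : List (Formula L n Δ)} {φ ψ} →
           Γ ⊢ ∃' φ → (φ ∷ List.map wkF Γ) ⊢ wkF ψ → Γ ⊢ ψ
  ∀²I    : ∀ {n Δ k} {Γ : List (Formula L n Δ)} {φ} → List.map wkS Γ ⊢ φ → Γ ⊢ ∀² k φ
  ∀²E    : ∀ {n Δ k} {Γ : List (Formula L n Δ)} {φ} → Γ ⊢ ∀² k φ → (Y : SVar Δ k) → Γ ⊢ instS φ Y
  ∃²I    : ∀ {n Δ k} {Γ : List (Formula L n Δ)} {φ} (Y : SVar Δ k) → Γ ⊢ instS φ Y → Γ ⊢ ∃² k φ
  ∃²E    : ∀ {n Δ k} {Γ : List (Formula L n Δ)} {φ ψ} →
           Γ ⊢ ∃² k φ → (φ ∷ List.map wkS Γ) ⊢ wkS ψ → Γ ⊢ ψ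
  ≐refl  : ∀ {n Δ} {Γ : List (Formula L n Δ)} (t : Term L n) → Γ ⊢ t ≐ t
  ≐subst : ∀ {n Δ} {Γ : List (Formula L n Δ)} {t s} (φ : Formula L (suc n) Δ) →
           Γ ⊢ t ≐ s → Γ ⊢ inst φ t → Γ ⊢ inst φ s
  comp   : ∀ {n Δ} {Γ : List (Formula L n Δ)} (k : ℕ) (ψ : Formula L (k + n) Δ) →
           Γ ⊢ Comprehension k ψ
  choice : ∀ {n Δ} {Γ : List (Formula L n Δ)} (k m : ℕ) (φ : Formula L (k + n) (m ∷ Δ)) →
           Γ ⊢ Choice k m φ

Inconsistent : {L : Signature} → List (Formula L 0 []) → Set
Inconsistent T = T ⊢ ⊥'

Arith : Signature
Arith = record { Const = ⊤ ; Fun1 = ⊤ ; Pred1 = ⊥ }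

zero' : ∀ {n} → Term Arith n
zero' = con tt

S' : ∀ {n} → Term Arith n → Term Arith n
S' = app tt

PA2-axioms : Vec (Formula Arith 0 []) 3
PA2-axioms =
    ∀' (¬' (S' (var zero) ≐ zero'))
  ∷ ∀' (∀' (S' (var (suc zero)) ≐ S' (var zero) ⇒ var (suc zero) ≐ var zero))
  ∷ ∀² 1 ((sapp here (zero' ∷ [])
            ∧' ∀' (sapp here (var zero ∷ []) ⇒ sapp here (S' (var zero) ∷ [])))
          ⇒ ∀' (sapp here (var zero ∷ [])))
  ∷ []

-- The two-copy vocabulary {N₁, 0₁, S₁, N₂, 0₂, S₂}; index j : Fin 2
-- (zero = copy 1, suc zero = copy 2).

Arith² : Signature
Arith² = record { Const = Fin 2 ; Fun1 = Fin 2 ; Pred1 = Fin 2 }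

N : ∀ {n Δ} → Fin 2 → Term Arith² n → Formula Arith² n Δ
N j t = prd j t

SubN : ∀ {n Δ} (j : Fin 2) (k : ℕ) → Formula Arith² n (k ∷ Δ)
SubN {n} j k = ∀ⁿ k (sapp here (vars k n) ⇒ ⋀ (map (N j) (vars k n)))

relT : ∀ {n} → Fin 2 → Term Arith n → Term Arith² n
relT j (var i) = var i
relT j (con _) = con j
relT j (app _ t) = app j (relT j t)

relF : ∀ {n Δ} → Fin 2 → Formula Arith n Δ → Formula Arith² n Δ
relF j (t ≐ s) = relT j t ≐ relT j s
relF j (prd () t)
relF j (sapp X ts) = sapp X (map (relT j) ts)
relF j ⊥' = ⊥'
relF j (φ ⇒ ψ) = relF j φ ⇒ relF j ψ
relF j (φ ∧' ψ) = relF j φ ∧' relF j ψ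
relF j (φ ∨' ψ) = relF j φ ∨' relF j ψ
relF j (∀' φ) = ∀' (N j (var zero) ⇒ relF j φ)
relF j (∃' φ) = ∃' (N j (var zero) ∧' relF j φ)
relF j (∀² k φ) = ∀² k (SubN j k ⇒ relF j φ)
relF j (∃² k φ) = ∃² k (SubN j k ∧' relF j φ)

PA2rel : Fin 2 → Formula Arith² 0 []
PA2rel j =
  ⋀ (map (relF j) PA2-axioms)
    ∧' N j (con j)
    ∧' ∀' (N j (var zero) ⇒ N j (app j (var zero)))

{-# OPTIONS --safe #-}
module Submission where

-- Inside the theory one defines R as the least relation containing (0₁, 0₂) and closed
-- under (x, y) ↦ (S₁ x, S₂ y).  Induction in each copy shows that R is the graph of a
-- bijection N₁ → N₂ respecting 0 and S, whose converse is the least relation of the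
-- same kind from copy 2 to copy 1.  By induction on formulas, R transports every
-- relativised formula from copy 1 to copy 2 whenever the free first-order variables
-- are R-related and the free relation variables correspond under R; at a second-order
-- quantifier, comprehension provides the R-preimage of a relation on N₂ (and the
-- R-image of one on N₁).  Hence φ^(N₁) implies φ^(N₂).

open import Defs
open import Data.Nat using (ℕ; zero; suc; _+_)
open import Data.Fin using (Fin; zero; suc; _↑ˡ_; _↑ʳ_)
open import Data.Vec using (Vec; []; _∷_; map; tabulate; lookup)
open import Data.List using (List; []; _∷_)
import Data.List as List
open import Data.List.Membership.Propositional using (_∈_)
open import Data.List.Membership.Propositional.Properties using (∈-map⁺; ∈-map⁻)
open import Data.List.Relation.Unary.Any using (here; there)
open import Data.List.Relation.Binary.Subset.Propositional using (_⊆_)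
open import Data.List.Relation.Binary.Subset.Propositional.Properties using (∷⁺ʳ; map⁺; ++⁺ʳ; xs⊆x∷xs)
open import Data.Product using (_,_)
open import Relation.Binary.PropositionalEquality
open import Function using (_∘_)
import Data.Vec.Properties as VecP

-- Defs' SRen has an unused signature parameter that Agda cannot infer.
Ren : List ℕ → List ℕ → Set
Ren Δ Δ' = ∀ {k} → SVar Δ k → SVar Δ' k

_∷ρ_ : ∀ {Δ Δ' k} → SVar Δ' k → Ren Δ Δ' → Ren (k ∷ Δ) Δ'
(Y ∷ρ ρ) here = Y
(Y ∷ρ ρ) (there v) = ρ v

instρ : ∀ {Δ k} → SVar Δ k → Ren (k ∷ Δ) Δ
instρ Y = Y ∷ρ (λ v → v)

module _ {L : Signature} where

  _⊙_ : ∀ {n m k} → (Fin n → Term L m) → (Fin m → Term L k) → Fin n → Term L k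
  (σ ⊙ τ) i = substT (σ i) τ

  wkσ : ∀ {n} → Fin n → Term L (suc n)
  wkσ i = var (suc i)

  _∷σ_ : ∀ {n m} → Term L m → (Fin n → Term L m) → Fin (suc n) → Term L m
  (t ∷σ σ) zero = t
  (t ∷σ σ) (suc i) = σ i

  instσ : ∀ {n} → Term L n → Fin (suc n) → Term L n
  instσ t = t ∷σ var

  substT-cong : ∀ {n m} (t : Term L n) {σ τ : Fin n → Term L m} → (∀ i → σ i ≡ τ i) → substT t σ ≡ substT t τ
  substT-cong (var i) e = e i
  substT-cong (con c) e = refl
  substT-cong (app f t) e = cong (app f) (substT-cong t e)

  substT-comp : ∀ {n m k} (t : Term L n) (σ : Fin n → Term L m) (τ : Fin m → Term L k) →
                substT (substT t σ) τ ≡ substT t (σ ⊙ τ)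
  substT-comp (var i) σ τ = refl
  substT-comp (con c) σ τ = refl
  substT-comp (app f t) σ τ = cong (app f) (substT-comp t σ τ)

  substT-id : ∀ {n} (t : Term L n) → substT t var ≡ t
  substT-id (var i) = refl
  substT-id (con c) = refl
  substT-id (app f t) = cong (app f) (substT-id t)

  wkT-instσ : ∀ {n} (t s : Term L n) → substT (wkT t) (instσ s) ≡ t
  wkT-instσ t s = trans (substT-comp t wkσ (instσ s)) (substT-id t)

  liftσ-cong : ∀ {n m} {σ τ : Fin n → Term L m} → (∀ i → σ i ≡ τ i) → ∀ i → liftσ σ i ≡ liftσ τ i
  liftσ-cong e zero = refl
  liftσ-cong e (suc i) = cong wkT (e i)

  liftσ-comp : ∀ {n m k} (σ : Fin n → Term L m) (τ : Fin m → Term L k) →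
               ∀ i → (liftσ σ ⊙ liftσ τ) i ≡ liftσ (σ ⊙ τ) i
  liftσ-comp σ τ zero = refl
  liftσ-comp σ τ (suc i) = trans (substT-comp (σ i) wkσ (liftσ τ)) (sym (substT-comp (σ i) τ wkσ))

  liftσ-id : ∀ {n} i → liftσ {L = L} {n = n} var i ≡ var i
  liftσ-id zero = refl
  liftσ-id (suc i) = refl

  substF-cong : ∀ {n m Δ} (φ : Formula L n Δ) {σ τ : Fin n → Term L m} → (∀ i → σ i ≡ τ i) → substF φ σ ≡ substF φ τ
  substF-cong (t ≐ s) e = cong₂ _≐_ (substT-cong t e) (substT-cong s e)
  substF-cong (prd P t) e = cong (prd P) (substT-cong t e)
  substF-cong (sapp X ts) e = cong (sapp X) (VecP.map-cong (λ t → substT-cong t e) ts)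
  substF-cong ⊥' e = refl
  substF-cong (φ ⇒ ψ) e = cong₂ _⇒_ (substF-cong φ e) (substF-cong ψ e)
  substF-cong (φ ∧' ψ) e = cong₂ _∧'_ (substF-cong φ e) (substF-cong ψ e)
  substF-cong (φ ∨' ψ) e = cong₂ _∨'_ (substF-cong φ e) (substF-cong ψ e)
  substF-cong (∀' φ) e = cong ∀' (substF-cong φ (liftσ-cong e))
  substF-cong (∃' φ) e = cong ∃' (substF-cong φ (liftσ-cong e))
  substF-cong (∀² k φ) e = cong (∀² k) (substF-cong φ e)
  substF-cong (∃² k φ) e = cong (∃² k) (substF-cong φ e)

  substF-comp : ∀ {n m k Δ} (φ : Formula L n Δ) (σ : Fin n → Term L m) (τ : Fin m → Term L k) →
                substF (substF φ σ) τ ≡ substF φ (σ ⊙ τ)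
  substF-comp (t ≐ s) σ τ = cong₂ _≐_ (substT-comp t σ τ) (substT-comp s σ τ)
  substF-comp (prd P t) σ τ = cong (prd P) (substT-comp t σ τ)
  substF-comp (sapp X ts) σ τ =
    cong (sapp X) (trans (sym (VecP.map-∘ _ _ ts)) (VecP.map-cong (λ t → substT-comp t σ τ) ts))
  substF-comp ⊥' σ τ = refl
  substF-comp (φ ⇒ ψ) σ τ = cong₂ _⇒_ (substF-comp φ σ τ) (substF-comp ψ σ τ)
  substF-comp (φ ∧' ψ) σ τ = cong₂ _∧'_ (substF-comp φ σ τ) (substF-comp ψ σ τ)
  substF-comp (φ ∨' ψ) σ τ = cong₂ _∨'_ (substF-comp φ σ τ) (substF-comp ψ σ τ)
  substF-comp (∀' φ) σ τ = cong ∀' (trans (substF-comp φ (liftσ σ) (liftσ τ)) (substF-cong φ (liftσ-comp σ τ)))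
  substF-comp (∃' φ) σ τ = cong ∃' (trans (substF-comp φ (liftσ σ) (liftσ τ)) (substF-cong φ (liftσ-comp σ τ)))
  substF-comp (∀² k φ) σ τ = cong (∀² k) (substF-comp φ σ τ)
  substF-comp (∃² k φ) σ τ = cong (∃² k) (substF-comp φ σ τ)

  substF-id : ∀ {n Δ} (φ : Formula L n Δ) → substF φ var ≡ φ
  substF-id (t ≐ s) = cong₂ _≐_ (substT-id t) (substT-id s)
  substF-id (prd P t) = cong (prd P) (substT-id t)
  substF-id (sapp X ts) = cong (sapp X) (trans (VecP.map-cong substT-id ts) (VecP.map-id ts))
  substF-id ⊥' = refl
  substF-id (φ ⇒ ψ) = cong₂ _⇒_ (substF-id φ) (substF-id ψ)
  substF-id (φ ∧' ψ) = cong₂ _∧'_ (substF-id φ) (substF-id ψ)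
  substF-id (φ ∨' ψ) = cong₂ _∨'_ (substF-id φ) (substF-id ψ)
  substF-id (∀' φ) = cong ∀' (trans (substF-cong φ liftσ-id) (substF-id φ))
  substF-id (∃' φ) = cong ∃' (trans (substF-cong φ liftσ-id) (substF-id φ))
  substF-id (∀² k φ) = cong (∀² k) (substF-id φ)
  substF-id (∃² k φ) = cong (∃² k) (substF-id φ)

  substF-id-pointwise : ∀ {n Δ} (φ : Formula L n Δ) {σ : Fin n → Term L n} → (∀ i → σ i ≡ var i) → substF φ σ ≡ φ
  substF-id-pointwise φ e = trans (substF-cong φ e) (substF-id φ)

  liftρ-cong : ∀ {Δ Δ' j} {ρ ρ' : Ren Δ Δ'} → (∀ {k} (v : SVar Δ k) → ρ v ≡ ρ' v) →
               ∀ {k} (v : SVar (j ∷ Δ) k) → liftρ {L = L} ρ v ≡ liftρ {L = L} ρ' v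
  liftρ-cong e here = refl
  liftρ-cong e (there v) = cong there (e v)

  renS-cong : ∀ {n Δ Δ'} (φ : Formula L n Δ) {ρ ρ' : Ren Δ Δ'} → (∀ {k} (v : SVar Δ k) → ρ v ≡ ρ' v) →
              renS φ ρ ≡ renS φ ρ'
  renS-cong (t ≐ s) e = refl
  renS-cong (prd P t) e = refl
  renS-cong (sapp X ts) e = cong (λ Y → sapp Y ts) (e X)
  renS-cong ⊥' e = refl
  renS-cong (φ ⇒ ψ) e = cong₂ _⇒_ (renS-cong φ e) (renS-cong ψ e)
  renS-cong (φ ∧' ψ) e = cong₂ _∧'_ (renS-cong φ e) (renS-cong ψ e)
  renS-cong (φ ∨' ψ) e = cong₂ _∨'_ (renS-cong φ e) (renS-cong ψ e)
  renS-cong (∀' φ) e = cong ∀' (renS-cong φ e)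
  renS-cong (∃' φ) e = cong ∃' (renS-cong φ e)
  renS-cong (∀² k φ) e = cong (∀² k) (renS-cong φ (liftρ-cong e))
  renS-cong (∃² k φ) e = cong (∃² k) (renS-cong φ (liftρ-cong e))

  liftρ-comp : ∀ {Δ Δ' Δ'' j} (ρ : Ren Δ Δ') (ρ' : Ren Δ' Δ'') →
               ∀ {k} (v : SVar (j ∷ Δ) k) → liftρ {L = L} ρ' (liftρ {L = L} ρ v) ≡ liftρ {L = L} (ρ' ∘ ρ) v
  liftρ-comp ρ ρ' here = refl
  liftρ-comp ρ ρ' (there v) = refl

  renS-comp : ∀ {n Δ Δ' Δ''} (φ : Formula L n Δ) (ρ : Ren Δ Δ') (ρ' : Ren Δ' Δ'') →
              renS (renS φ ρ) ρ' ≡ renS φ (ρ' ∘ ρ)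
  renS-comp (t ≐ s) ρ ρ' = refl
  renS-comp (prd P t) ρ ρ' = refl
  renS-comp (sapp X ts) ρ ρ' = refl
  renS-comp ⊥' ρ ρ' = refl
  renS-comp (φ ⇒ ψ) ρ ρ' = cong₂ _⇒_ (renS-comp φ ρ ρ') (renS-comp ψ ρ ρ')
  renS-comp (φ ∧' ψ) ρ ρ' = cong₂ _∧'_ (renS-comp φ ρ ρ') (renS-comp ψ ρ ρ')
  renS-comp (φ ∨' ψ) ρ ρ' = cong₂ _∨'_ (renS-comp φ ρ ρ') (renS-comp ψ ρ ρ')
  renS-comp (∀' φ) ρ ρ' = cong ∀' (renS-comp φ ρ ρ')
  renS-comp (∃' φ) ρ ρ' = cong ∃' (renS-comp φ ρ ρ')
  renS-comp (∀² k φ) ρ ρ' = cong (∀² k) (trans (renS-comp φ (liftρ ρ) (liftρ ρ')) (renS-cong φ (liftρ-comp ρ ρ')))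
  renS-comp (∃² k φ) ρ ρ' = cong (∃² k) (trans (renS-comp φ (liftρ ρ) (liftρ ρ')) (renS-cong φ (liftρ-comp ρ ρ')))

  renS-substF : ∀ {n m Δ Δ'} (φ : Formula L n Δ) (σ : Fin n → Term L m) (ρ : Ren Δ Δ') →
                renS (substF φ σ) ρ ≡ substF (renS φ ρ) σ
  renS-substF (t ≐ s) σ ρ = refl
  renS-substF (prd P t) σ ρ = refl
  renS-substF (sapp X ts) σ ρ = refl
  renS-substF ⊥' σ ρ = refl
  renS-substF (φ ⇒ ψ) σ ρ = cong₂ _⇒_ (renS-substF φ σ ρ) (renS-substF ψ σ ρ)
  renS-substF (φ ∧' ψ) σ ρ = cong₂ _∧'_ (renS-substF φ σ ρ) (renS-substF ψ σ ρ)
  renS-substF (φ ∨' ψ) σ ρ = cong₂ _∨'_ (renS-substF φ σ ρ) (renS-substF ψ σ ρ)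
  renS-substF (∀' φ) σ ρ = cong ∀' (renS-substF φ (liftσ σ) ρ)
  renS-substF (∃' φ) σ ρ = cong ∃' (renS-substF φ (liftσ σ) ρ)
  renS-substF (∀² k φ) σ ρ = cong (∀² k) (renS-substF φ σ (liftρ ρ))
  renS-substF (∃² k φ) σ ρ = cong (∃² k) (renS-substF φ σ (liftρ ρ))

  inst≡substF : ∀ {n Δ} (φ : Formula L (suc n) Δ) (t : Term L n) → inst φ t ≡ substF φ (instσ t)
  inst≡substF φ t = substF-cong φ (λ { zero → refl ; (suc i) → refl })

  instS≡renS : ∀ {n Δ k} (φ : Formula L n (k ∷ Δ)) (Y : SVar Δ k) → instS φ Y ≡ renS φ (instρ Y)
  instS≡renS φ Y = renS-cong φ (λ { here → refl ; (there v) → refl })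

module _ {L : Signature} where

  weaken : ∀ {n Δ} {Γ Γ' : List (Formula L n Δ)} {φ} → Γ ⊆ Γ' → Γ ⊢ φ → Γ' ⊢ φ
  weaken s (assume p) = assume (s p)
  weaken s (⊥E d) = ⊥E (weaken s d)
  weaken s (raa d) = raa (weaken (∷⁺ʳ _ s) d)
  weaken s (⇒I d) = ⇒I (weaken (∷⁺ʳ _ s) d)
  weaken s (⇒E d e) = ⇒E (weaken s d) (weaken s e)
  weaken s (∧I d e) = ∧I (weaken s d) (weaken s e)
  weaken s (∧E₁ d) = ∧E₁ (weaken s d)
  weaken s (∧E₂ d) = ∧E₂ (weaken s d)
  weaken s (∨I₁ d) = ∨I₁ (weaken s d)
  weaken s (∨I₂ d) = ∨I₂ (weaken s d)
  weaken s (∨E d e f) = ∨E (weaken s d) (weaken (∷⁺ʳ _ s) e) (weaken (∷⁺ʳ _ s) f)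
  weaken s (∀I d) = ∀I (weaken (map⁺ wkF s) d)
  weaken s (∀E d t) = ∀E (weaken s d) t
  weaken s (∃I t d) = ∃I t (weaken s d)
  weaken s (∃E d e) = ∃E (weaken s d) (weaken (∷⁺ʳ _ (map⁺ wkF s)) e)
  weaken s (∀²I d) = ∀²I (weaken (map⁺ wkS s) d)
  weaken s (∀²E d Y) = ∀²E (weaken s d) Y
  weaken s (∃²I Y d) = ∃²I Y (weaken s d)
  weaken s (∃²E d e) = ∃²E (weaken s d) (weaken (∷⁺ʳ _ (map⁺ wkS s)) e)
  weaken s (≐refl t) = ≐refl t
  weaken s (≐subst φ d e) = ≐subst φ (weaken s d) (weaken s e)
  weaken s (comp k ψ) = comp k ψ
  weaken s (choice k m φ) = choice k m φ

  weaken₁ : ∀ {n Δ} {Γ : List (Formula L n Δ)} {φ ψ} → Γ ⊢ φ → (ψ ∷ Γ) ⊢ φ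
  weaken₁ = weaken there

  cast : ∀ {n Δ} {Γ : List (Formula L n Δ)} {φ ψ} → φ ≡ ψ → Γ ⊢ φ → Γ ⊢ ψ
  cast refl d = d

  cut : ∀ {n Δ} {Γ : List (Formula L n Δ)} {φ ψ} → Γ ⊢ φ → (φ ∷ Γ) ⊢ ψ → Γ ⊢ ψ
  cut d e = ⇒E (⇒I e) d

  assume₀ : ∀ {n Δ} {Γ : List (Formula L n Δ)} {φ} → (φ ∷ Γ) ⊢ φ
  assume₀ = assume (here refl)

  ∈-wkF : ∀ {n Δ} {φ : Formula L n Δ} {Γ} → φ ∈ Γ → wkF φ ∈ List.map wkF Γ
  ∈-wkF = ∈-map⁺ wkF

  ∈-wkF² : ∀ {n Δ} {φ : Formula L n Δ} {Γ} → φ ∈ Γ → wkF (wkF φ) ∈ List.map wkF (List.map wkF Γ)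
  ∈-wkF² = ∈-wkF ∘ ∈-wkF

  ∈-wkF³ : ∀ {n Δ} {φ : Formula L n Δ} {Γ} → φ ∈ Γ → wkF (wkF (wkF φ)) ∈ List.map wkF (List.map wkF (List.map wkF Γ))
  ∈-wkF³ = ∈-wkF ∘ ∈-wkF²

  ∈-wkS : ∀ {n Δ k} {φ : Formula L n Δ} {Γ} → φ ∈ Γ → wkS {j = k} φ ∈ List.map wkS Γ
  ∈-wkS = ∈-map⁺ wkS

  ∀E-substF : ∀ {n Δ} {Γ : List (Formula L n Δ)} {φ} → Γ ⊢ ∀' φ → (t : Term L n) → Γ ⊢ substF φ (instσ t)
  ∀E-substF {φ = φ} d t = cast (inst≡substF φ t) (∀E d t)

  -- In ∀x∀y φ, x is var 1 and y is var 0; the instances below put t for x and s for y.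
  instσ₂ : ∀ {n} → Term L n → Term L n → Fin (suc (suc n)) → Term L n
  instσ₂ t s = s ∷σ (t ∷σ var)

  instσ₃ : ∀ {n} → Term L n → Term L n → Term L n → Fin (suc (suc (suc n))) → Term L n
  instσ₃ t s u = u ∷σ (s ∷σ (t ∷σ var))

  ∀E₂ : ∀ {n Δ} {Γ : List (Formula L n Δ)} {φ} → Γ ⊢ ∀' (∀' φ) → (t s : Term L n) → Γ ⊢ substF φ (instσ₂ t s)
  ∀E₂ {φ = φ} d t s =
    cast (trans (substF-comp φ (liftσ (instσ t)) (instσ s))
                (substF-cong φ (λ { zero → refl ; (suc zero) → wkT-instσ t s ; (suc (suc i)) → refl })))
         (∀E-substF (∀E-substF d t) s)

  ∀E₃ : ∀ {n Δ} {Γ : List (Formula L n Δ)} {φ} → Γ ⊢ ∀' (∀' (∀' φ)) → (t s u : Term L n) →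
        Γ ⊢ substF φ (instσ₃ t s u)
  ∀E₃ {φ = φ} d t s u =
    cast (trans (substF-comp φ (liftσ (instσ₂ t s)) (instσ u))
                (substF-cong φ (λ { zero → refl ; (suc zero) → wkT-instσ s u ; (suc (suc zero)) → wkT-instσ t u
                                  ; (suc (suc (suc i))) → refl })))
         (∀E-substF (∀E₂ d t s) u)

data Split (k m : ℕ) : Fin (k + m) → Set where
  inl : ∀ i → Split k m (i ↑ˡ m)
  inr : ∀ j → Split k m (k ↑ʳ j)

split : ∀ k {m} (x : Fin (k + m)) → Split k m x
split zero x = inr x
split (suc k) zero = inl zero
split (suc k) (suc x) with split k x
... | inl i = inl (suc i)
... | inr j = inr j

module _ {L : Signature} where

  bv : ∀ {k m} → Fin k → Term L (k + m)
  bv {m = m} i = var (i ↑ˡ m)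

  wkⁿσ : ∀ k {m} → Fin m → Term L (k + m)
  wkⁿσ k j = var (k ↑ʳ j)

  wkTⁿ : ∀ k {m} → Term L m → Term L (k + m)
  wkTⁿ k t = substT t (wkⁿσ k)

  wkFⁿ : ∀ k {m Δ} → Formula L m Δ → Formula L (k + m) Δ
  wkFⁿ k φ = substF φ (wkⁿσ k)

  ∈-wkFⁿ : ∀ k {m Δ} {φ : Formula L m Δ} {Γ} → φ ∈ Γ → wkFⁿ k φ ∈ List.map (wkFⁿ k) Γ
  ∈-wkFⁿ k = ∈-map⁺ (wkFⁿ k)

  liftⁿ : ∀ k {n m} → (Fin n → Term L m) → Fin (k + n) → Term L (k + m)
  liftⁿ zero σ = σ
  liftⁿ (suc k) σ = liftσ (liftⁿ k σ)

  instⁿσ : ∀ k {m} → (Fin k → Term L m) → Fin (k + m) → Term L m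
  instⁿσ zero τ x = var x
  instⁿσ (suc k) τ zero = τ zero
  instⁿσ (suc k) τ (suc x) = instⁿσ k (τ ∘ suc) x

  liftⁿ-↑ˡ : ∀ k {n m} (σ : Fin n → Term L m) (i : Fin k) → liftⁿ k σ (i ↑ˡ n) ≡ var (i ↑ˡ m)
  liftⁿ-↑ˡ (suc k) σ zero = refl
  liftⁿ-↑ˡ (suc k) σ (suc i) = cong wkT (liftⁿ-↑ˡ k σ i)

  liftⁿ-↑ʳ : ∀ k {n m} (σ : Fin n → Term L m) (j : Fin n) → liftⁿ k σ (k ↑ʳ j) ≡ wkTⁿ k (σ j)
  liftⁿ-↑ʳ zero σ j = sym (substT-id (σ j))
  liftⁿ-↑ʳ (suc k) σ j = trans (cong wkT (liftⁿ-↑ʳ k σ j)) (substT-comp (σ j) (wkⁿσ k) wkσ)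

  instⁿσ-↑ˡ : ∀ k {m} (τ : Fin k → Term L m) (i : Fin k) → instⁿσ k τ (i ↑ˡ m) ≡ τ i
  instⁿσ-↑ˡ (suc k) τ zero = refl
  instⁿσ-↑ˡ (suc k) τ (suc i) = instⁿσ-↑ˡ k (τ ∘ suc) i

  instⁿσ-↑ʳ : ∀ k {m} (τ : Fin k → Term L m) (j : Fin m) → instⁿσ k τ (k ↑ʳ j) ≡ var j
  instⁿσ-↑ʳ zero τ j = refl
  instⁿσ-↑ʳ (suc k) τ j = instⁿσ-↑ʳ k (τ ∘ suc) j

  wkTⁿ-instⁿσ : ∀ k {m} (τ : Fin k → Term L m) (t : Term L m) → substT (wkTⁿ k t) (instⁿσ k τ) ≡ t
  wkTⁿ-instⁿσ k τ t =
    trans (substT-comp t (wkⁿσ k) (instⁿσ k τ)) (trans (substT-cong t (instⁿσ-↑ʳ k τ)) (substT-id t))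

  wkTⁿ-liftⁿ : ∀ k {n m} (t : Term L n) (σ : Fin n → Term L m) →
               substT (wkTⁿ k t) (liftⁿ k σ) ≡ wkTⁿ k (substT t σ)
  wkTⁿ-liftⁿ k t σ = trans (substT-comp t (wkⁿσ k) (liftⁿ k σ))
                      (trans (substT-cong t (liftⁿ-↑ʳ k σ)) (sym (substT-comp t σ (wkⁿσ k))))

  substF-∀ⁿ : ∀ k {n m Δ} (ψ : Formula L (k + n) Δ) (σ : Fin n → Term L m) →
              substF (∀ⁿ k ψ) σ ≡ ∀ⁿ k (substF ψ (liftⁿ k σ))
  substF-∀ⁿ zero ψ σ = refl
  substF-∀ⁿ (suc k) ψ σ = substF-∀ⁿ k (∀' ψ) σ

  renS-∀ⁿ : ∀ k {n Δ Δ'} (ψ : Formula L (k + n) Δ) (ρ : Ren Δ Δ') → renS (∀ⁿ k ψ) ρ ≡ ∀ⁿ k (renS ψ ρ)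
  renS-∀ⁿ zero ψ ρ = refl
  renS-∀ⁿ (suc k) ψ ρ = renS-∀ⁿ k (∀' ψ) ρ

  ∀ⁿI : ∀ k {m Δ} {Γ : List (Formula L m Δ)} {ψ} → List.map (wkFⁿ k) Γ ⊢ ψ → Γ ⊢ ∀ⁿ k ψ
  ∀ⁿI zero {Γ = Γ} d = weaken s d
    where
      s : List.map (wkFⁿ zero) Γ ⊆ Γ
      s p with ∈-map⁻ (wkFⁿ zero) p
      ... | x , x∈ , refl = subst (_∈ Γ) (sym (substF-id x)) x∈
  ∀ⁿI (suc k) {Γ = Γ} d = ∀ⁿI k (∀I (weaken s d))
    where
      s : List.map (wkFⁿ (suc k)) Γ ⊆ List.map wkF (List.map (wkFⁿ k) Γ)
      s p with ∈-map⁻ (wkFⁿ (suc k)) p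
      ... | x , x∈ , refl = subst (_∈ _) (substF-comp x (wkⁿσ k) wkσ) (∈-wkF (∈-wkFⁿ k x∈))

  ∀ⁿE : ∀ k {m Δ} {Γ : List (Formula L m Δ)} {ψ} → Γ ⊢ ∀ⁿ k ψ → (τ : Fin k → Term L m) →
        Γ ⊢ substF ψ (instⁿσ k τ)
  ∀ⁿE zero {ψ = ψ} d τ = cast (sym (substF-id ψ)) d
  ∀ⁿE (suc k) {ψ = ψ} d τ =
    cast (trans (substF-comp ψ (liftσ (instⁿσ k (τ ∘ suc))) (instσ (τ zero)))
                (substF-cong ψ (λ { zero → refl ; (suc x) → wkT-instσ (instⁿσ k (τ ∘ suc) x) (τ zero) })))
         (∀E-substF (∀ⁿE k d (τ ∘ suc)) (τ zero))

  openⁿ : ∀ k {m Δ} {Γ : List (Formula L (k + m) Δ)} {A : Formula L (k + m) Δ} →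
          Γ ⊢ wkFⁿ k (∀ⁿ k A) → Γ ⊢ A
  openⁿ k {m} {A = A} d = cast reopen (∀ⁿE k (cast (substF-∀ⁿ k A (wkⁿσ k)) d) bv)
    where
      pointwise : ∀ x → (liftⁿ k (wkⁿσ k) ⊙ instⁿσ k (bv {m = m})) x ≡ var x
      pointwise x with split k x
      ... | inl i = trans (cong (λ t → substT t (instⁿσ k bv)) (liftⁿ-↑ˡ k (wkⁿσ k) i)) (instⁿσ-↑ˡ k bv i)
      ... | inr j = trans (cong (λ t → substT t (instⁿσ k bv)) (liftⁿ-↑ʳ k (wkⁿσ k) j)) (instⁿσ-↑ʳ k bv (k ↑ʳ j))
      reopen : substF (substF A (liftⁿ k (wkⁿσ k))) (instⁿσ k bv) ≡ A
      reopen = trans (substF-comp A _ _) (substF-id-pointwise A pointwise)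

  sappF : ∀ {n Δ k} → SVar Δ k → (Fin k → Term L n) → Formula L n Δ
  sappF X x = sapp X (tabulate x)

  andF : ∀ {n Δ k} → (Fin k → Formula L n Δ) → Formula L n Δ
  andF P = ⋀ (tabulate P)

  substF-sappF : ∀ {n m Δ k} (X : SVar Δ k) (x : Fin k → Term L n) (σ : Fin n → Term L m) →
                 substF (sappF X x) σ ≡ sappF X (λ i → substT (x i) σ)
  substF-sappF X x σ = cong (sapp X) (sym (VecP.tabulate-∘ _ x))

  sappF-cong : ∀ {n Δ k} (X : SVar Δ k) {x y : Fin k → Term L n} → (∀ i → x i ≡ y i) → sappF X x ≡ sappF X y
  sappF-cong X e = cong (sapp X) (VecP.tabulate-cong e)

  substF-andF : ∀ {n m Δ} k (P : Fin k → Formula L n Δ) (σ : Fin n → Term L m) →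
                substF (andF P) σ ≡ andF (λ i → substF (P i) σ)
  substF-andF zero P σ = refl
  substF-andF (suc k) P σ = cong (substF (P zero) σ ∧'_) (substF-andF k (P ∘ suc) σ)

  renS-andF : ∀ {n Δ Δ'} k (P : Fin k → Formula L n Δ) (ρ : Ren Δ Δ') →
              renS (andF P) ρ ≡ andF (λ i → renS (P i) ρ)
  renS-andF zero P ρ = refl
  renS-andF (suc k) P ρ = cong (renS (P zero) ρ ∧'_) (renS-andF k (P ∘ suc) ρ)

  andF-cong : ∀ {n Δ} k {P Q : Fin k → Formula L n Δ} → (∀ i → P i ≡ Q i) → andF P ≡ andF Q
  andF-cong k e = cong ⋀ (VecP.tabulate-cong e)

  andI : ∀ {n Δ} k {Γ : List (Formula L n Δ)} {P : Fin k → Formula L n Δ} → (∀ i → Γ ⊢ P i) → Γ ⊢ andF P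
  andI zero d = ⇒I assume₀
  andI (suc k) d = ∧I (d zero) (andI k (d ∘ suc))

  andE : ∀ {n Δ} k {Γ : List (Formula L n Δ)} {P : Fin k → Formula L n Δ} → Γ ⊢ andF P → ∀ i → Γ ⊢ P i
  andE (suc k) d zero = ∧E₁ d
  andE (suc k) d (suc i) = andE k (∧E₂ d) i

  ⋀map≡andF : ∀ {n Δ k} (f : Term L n → Formula L n Δ) (x : Fin k → Term L n) →
              ⋀ (map f (tabulate x)) ≡ andF (λ i → f (x i))
  ⋀map≡andF f x = cong ⋀ (sym (VecP.tabulate-∘ f x))

  record VecContext {n Δ} (K : ℕ) : Set where
    field
      plug  : Vec (Term L n) K → Formula L n Δ
      plug₁ : Vec (Term L (suc n)) K → Formula L (suc n) Δ
      inst-plug₁ : ∀ u s → inst (plug₁ u) s ≡ plug (map (λ t → substT t (instσ s)) u)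
  open VecContext

  fixHead : ∀ {n Δ K} → VecContext {n} {Δ} (suc K) → Term L n → VecContext {n} {Δ} K
  plug (fixHead C b) u = plug C (b ∷ u)
  plug₁ (fixHead C b) u = plug₁ C (wkT b ∷ u)
  inst-plug₁ (fixHead C b) u s = trans (inst-plug₁ C (wkT b ∷ u) s) (cong (λ z → plug C (z ∷ _)) (wkT-instσ b s))

  map-wkT-instσ : ∀ {n K} (v : Vec (Term L n) K) s → map (λ t → substT t (instσ s)) (map wkT v) ≡ v
  map-wkT-instσ [] s = refl
  map-wkT-instσ (t ∷ v) s = cong₂ _∷_ (wkT-instσ t s) (map-wkT-instσ v s)

  ≐subst-vec : ∀ {n Δ K} (C : VecContext {n} {Δ} K) {Γ : List (Formula L n Δ)} (v w : Vec (Term L n) K) →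
               (∀ p → Γ ⊢ lookup v p ≐ lookup w p) → Γ ⊢ plug C v → Γ ⊢ plug C w
  ≐subst-vec C [] [] eqs d = d
  ≐subst-vec {n} {Δ} C {Γ} (a ∷ v) (b ∷ w) eqs d = ≐subst-vec (fixHead C b) v w (eqs ∘ suc) rewriteHead
    where
      φ : Formula L (suc n) Δ
      φ = plug₁ C (var zero ∷ map wkT v)
      instAt : ∀ c → inst φ c ≡ plug C (c ∷ v)
      instAt c = trans (inst-plug₁ C _ c) (cong (λ z → plug C (c ∷ z)) (map-wkT-instσ v c))
      rewriteHead : Γ ⊢ plug C (b ∷ v)
      rewriteHead = cast (instAt b) (≐subst φ (eqs zero) (cast (sym (instAt a)) d))

  sappContext : ∀ {n Δ K} → SVar Δ K → VecContext {n} {Δ} K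
  plug (sappContext X) u = sapp X u
  plug₁ (sappContext X) u = sapp X u
  inst-plug₁ (sappContext X) u s = inst≡substF (sapp X u) s

  ≐subst-sappF : ∀ {n Δ K} {Γ : List (Formula L n Δ)} (X : SVar Δ K) (x y : Fin K → Term L n) →
                 Γ ⊢ andF (λ i → x i ≐ y i) → Γ ⊢ sappF X x → Γ ⊢ sappF X y
  ≐subst-sappF {K = K} X x y e =
    ≐subst-vec (sappContext X) (tabulate x) (tabulate y)
      (λ p → cast (cong₂ _≐_ (sym (VecP.lookup∘tabulate x p)) (sym (VecP.lookup∘tabulate y p))) (andE K e p))

Fm : ℕ → List ℕ → Set
Fm n Δ = Formula Arith² n Δ

Tm : ℕ → Set
Tm n = Term Arith² n

sapp₂ : ∀ {n Δ} → SVar Δ 2 → Tm n → Tm n → Fm n Δ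
sapp₂ R t s = sapp R (t ∷ s ∷ [])

v0 : ∀ {n} → Tm (suc n)
v0 = var zero

v1 : ∀ {n} → Tm (suc (suc n))
v1 = var (suc zero)

v2 : ∀ {n} → Tm (suc (suc (suc n)))
v2 = var (suc (suc zero))

-- Defs.SubN for an arbitrary relation variable X rather than the newest one.
SubNVar : ∀ {n Δ} (j : Fin 2) (k : ℕ) → SVar Δ k → Fm n Δ
SubNVar {n} j k X = ∀ⁿ k (sapp X (vars k n) ⇒ ⋀ (map (N j) (vars k n)))

RangeIn : ∀ {n Δ} → Fin 2 → SVar Δ 2 → Fm n Δ
RangeIn j R = ∀' (∀' (sapp₂ R v1 v0 ⇒ N j v0))

RetractionOf : ∀ {n Δ} → SVar Δ 2 → SVar Δ 2 → Fm n Δ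
RetractionOf R R' = ∀' (∀' (∀' (sapp₂ R' v2 v1 ⇒ sapp₂ R v1 v0 ⇒ v2 ≐ v0)))

Carries-at : ∀ {n Δ k} → SVar Δ 2 → SVar Δ k → SVar Δ k → (Fin k → Tm n) → (Fin k → Tm n) → Fm n Δ
Carries-at R A B x y = andF (λ i → sapp₂ R (x i) (y i)) ⇒ sappF A x ⇒ sappF B y

Carries : ∀ {m Δ} k → SVar Δ 2 → SVar Δ k → SVar Δ k → Fm m Δ
Carries {m} k R A B = ∀ⁿ k (∀ⁿ k (Carries-at R A B (λ i → wkTⁿ k (bv {m = m} i)) bv))

substF-Carries-at : ∀ {n m Δ k} (R : SVar Δ 2) (A B : SVar Δ k) (x y : Fin k → Tm n) (σ : Fin n → Tm m) →
                    substF (Carries-at R A B x y) σ ≡ Carries-at R A B (λ i → substT (x i) σ) (λ i → substT (y i) σ)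
substF-Carries-at {k = k} R A B x y σ =
  cong₂ _⇒_ (substF-andF k _ σ) (cong₂ _⇒_ (substF-sappF A x σ) (substF-sappF B y σ))

Carries-at-cong : ∀ {n Δ k} (R : SVar Δ 2) (A B : SVar Δ k) {x x' y y' : Fin k → Tm n} →
                  (∀ i → x i ≡ x' i) → (∀ i → y i ≡ y' i) → Carries-at R A B x y ≡ Carries-at R A B x' y'
Carries-at-cong {k = k} R A B ex ey =
  cong₂ _⇒_ (andF-cong k (λ i → cong₂ (sapp₂ R) (ex i) (ey i))) (cong₂ _⇒_ (sappF-cong A ex) (sappF-cong B ey))

substF-Carries : ∀ {n m Δ} k (R : SVar Δ 2) (A B : SVar Δ k) (σ : Fin n → Tm m) →
                 substF (Carries k R A B) σ ≡ Carries k R A B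
substF-Carries k R A B σ =
  trans (substF-∀ⁿ k _ σ) (cong (∀ⁿ k) (trans (substF-∀ⁿ k _ (liftⁿ k σ)) (cong (∀ⁿ k)
    (trans (substF-Carries-at R A B _ _ _)
      (Carries-at-cong R A B (λ i → trans (wkTⁿ-liftⁿ k (bv i) (liftⁿ k σ)) (cong (wkTⁿ k) (liftⁿ-↑ˡ k σ i)))
                             (liftⁿ-↑ˡ k (liftⁿ k σ)))))))

renS-Carries : ∀ {m Δ Δ'} k (R : SVar Δ 2) (A B : SVar Δ k) (ρ : Ren Δ Δ') →
               renS (Carries {m} k R A B) ρ ≡ Carries k (ρ R) (ρ A) (ρ B)
renS-Carries k R A B ρ =
  trans (renS-∀ⁿ k _ ρ) (cong (∀ⁿ k) (trans (renS-∀ⁿ k _ ρ) (cong (∀ⁿ k) (cong (_⇒ _) (renS-andF k _ ρ)))))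

Carries-inst : ∀ {m Δ k} {Γ : List (Fm m Δ)} {R : SVar Δ 2} {A B : SVar Δ k} →
               Γ ⊢ Carries k R A B → (x y : Fin k → Tm m) → Γ ⊢ Carries-at R A B x y
Carries-inst {m} {k = k} {R = R} {A} {B} d x y =
  cast (trans (substF-comp (Carries-at R A B _ _) (liftⁿ k (instⁿσ k x)) (instⁿσ k y))
       (trans (substF-Carries-at R A B _ _ _) (Carries-at-cong R A B atX atY)))
    (∀ⁿE k (cast (substF-∀ⁿ k _ (instⁿσ k x)) (∀ⁿE k d x)) y)
  where
    atX : ∀ i → substT (wkTⁿ k (bv {m = m} i)) (liftⁿ k (instⁿσ k x) ⊙ instⁿσ k y) ≡ x i
    atX i = trans (sym (substT-comp (wkTⁿ k (bv i)) (liftⁿ k (instⁿσ k x)) (instⁿσ k y)))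
            (trans (cong (λ t → substT t (instⁿσ k y)) (wkTⁿ-liftⁿ k (bv i) (instⁿσ k x)))
            (trans (wkTⁿ-instⁿσ k y _) (instⁿσ-↑ˡ k x i)))
    atY : ∀ i → substT (bv {m = k + m} i) (liftⁿ k (instⁿσ k x) ⊙ instⁿσ k y) ≡ y i
    atY i = trans (cong (λ t → substT t (instⁿσ k y)) (liftⁿ-↑ˡ k (instⁿσ k x) i)) (instⁿσ-↑ˡ k y i)

-- Pulling a relation on N_B back along R : N_A → N_B

ImagesInBody : ∀ {n Δ k} → SVar Δ 2 → SVar Δ k → (Fin k → Tm n) → Fm (k + n) Δ
ImagesInBody {n} {k = k} R B x = andF (λ i → sapp₂ R (wkTⁿ k (x i)) (bv {m = n} i)) ⇒ sappF B bv

Preimage : ∀ {n Δ k} → Fin 2 → SVar Δ 2 → SVar Δ k → (Fin k → Tm n) → Fm n Δ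
Preimage {k = k} jA R B x = andF (λ i → N jA (x i)) ∧' ∀ⁿ k (ImagesInBody R B x)

ImagesInBody-inst : ∀ {n Δ k} (R : SVar Δ 2) (B : SVar Δ k) (x y : Fin k → Tm n) →
                    substF (ImagesInBody R B x) (instⁿσ k y) ≡ (andF (λ i → sapp₂ R (x i) (y i)) ⇒ sappF B y)
ImagesInBody-inst {k = k} R B x y =
  cong₂ _⇒_ (trans (substF-andF k _ _) (andF-cong k (λ i → cong₂ (sapp₂ R) (wkTⁿ-instⁿσ k y (x i)) (instⁿσ-↑ˡ k y i))))
            (trans (substF-sappF B _ _) (sappF-cong B (instⁿσ-↑ˡ k y)))

substF-ImagesInBody : ∀ {n m Δ k} (R : SVar Δ 2) (B : SVar Δ k) (x : Fin k → Tm n) (σ : Fin n → Tm m) →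
                      substF (ImagesInBody R B x) (liftⁿ k σ) ≡ ImagesInBody R B (λ i → substT (x i) σ)
substF-ImagesInBody {k = k} R B x σ =
  cong₂ _⇒_ (trans (substF-andF k _ _) (andF-cong k (λ i → cong₂ (sapp₂ R) (wkTⁿ-liftⁿ k (x i) σ) (liftⁿ-↑ˡ k σ i))))
            (trans (substF-sappF B _ _) (sappF-cong B (liftⁿ-↑ˡ k σ)))

Preimage-cong : ∀ {n Δ k} jA (R : SVar Δ 2) (B : SVar Δ k) {x y : Fin k → Tm n} → (∀ i → x i ≡ y i) →
                Preimage jA R B x ≡ Preimage jA R B y
Preimage-cong {k = k} jA R B e =
  cong₂ _∧'_ (andF-cong k (λ i → cong (N jA) (e i)))
             (cong (∀ⁿ k) (cong (_⇒ _) (andF-cong k (λ i → cong (λ t → sapp₂ R (wkTⁿ k t) _) (e i)))))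

substF-Preimage : ∀ {n m Δ k} jA (R : SVar Δ 2) (B : SVar Δ k) (x : Fin k → Tm n) (σ : Fin n → Tm m) →
                  substF (Preimage jA R B x) σ ≡ Preimage jA R B (λ i → substT (x i) σ)
substF-Preimage {k = k} jA R B x σ =
  cong₂ _∧'_ (substF-andF k _ σ) (trans (substF-∀ⁿ k _ σ) (cong (∀ⁿ k) (substF-ImagesInBody R B x σ)))

renS-Preimage : ∀ {n Δ Δ' k} jA (R : SVar Δ 2) (B : SVar Δ k) (x : Fin k → Tm n) (ρ : Ren Δ Δ') →
                renS (Preimage jA R B x) ρ ≡ Preimage jA (ρ R) (ρ B) x
renS-Preimage {k = k} jA R B x ρ =
  cong₂ _∧'_ (renS-andF k _ ρ) (trans (renS-∀ⁿ k _ ρ) (cong (∀ⁿ k) (cong (_⇒ _) (renS-andF k _ ρ))))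

IsPreimage-at : ∀ {n Δ k} → Fin 2 → SVar Δ 2 → SVar Δ k → SVar Δ k → (Fin k → Tm n) → Fm n Δ
IsPreimage-at jA R B X x = sappF X x ⇔ Preimage jA R B x

IsPreimage : ∀ {m Δ} k → Fin 2 → SVar Δ 2 → SVar Δ k → SVar Δ k → Fm m Δ
IsPreimage {m} k jA R B X = ∀ⁿ k (IsPreimage-at jA R B X (bv {m = m}))

substF-IsPreimage-at : ∀ {n m Δ k} jA (R : SVar Δ 2) (B X : SVar Δ k) (x : Fin k → Tm n) (σ : Fin n → Tm m) →
                       substF (IsPreimage-at jA R B X x) σ ≡ IsPreimage-at jA R B X (λ i → substT (x i) σ)
substF-IsPreimage-at jA R B X x σ =
  cong₂ _∧'_ (cong₂ _⇒_ (substF-sappF X x σ) (substF-Preimage jA R B x σ))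
             (cong₂ _⇒_ (substF-Preimage jA R B x σ) (substF-sappF X x σ))

IsPreimage-at-cong : ∀ {n Δ k} jA (R : SVar Δ 2) (B X : SVar Δ k) {x y : Fin k → Tm n} → (∀ i → x i ≡ y i) →
                     IsPreimage-at jA R B X x ≡ IsPreimage-at jA R B X y
IsPreimage-at-cong jA R B X e =
  cong₂ _∧'_ (cong₂ _⇒_ (sappF-cong X e) (Preimage-cong jA R B e))
             (cong₂ _⇒_ (Preimage-cong jA R B e) (sappF-cong X e))

substF-IsPreimage : ∀ {n m Δ} k jA (R : SVar Δ 2) (B X : SVar Δ k) (σ : Fin n → Tm m) →
                    substF (IsPreimage k jA R B X) σ ≡ IsPreimage k jA R B X
substF-IsPreimage k jA R B X σ =
  trans (substF-∀ⁿ k _ σ)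
        (cong (∀ⁿ k) (trans (substF-IsPreimage-at jA R B X _ _) (IsPreimage-at-cong jA R B X (liftⁿ-↑ˡ k σ))))

IsPreimage-inst : ∀ {m Δ k} {Γ : List (Fm m Δ)} {jA R B X} →
                  IsPreimage k jA R B X ∈ Γ → (x : Fin k → Tm m) → Γ ⊢ IsPreimage-at jA R B X x
IsPreimage-inst {k = k} {jA = jA} {R} {B} {X} p x =
  cast (trans (substF-IsPreimage-at jA R B X _ _) (IsPreimage-at-cong jA R B X (instⁿσ-↑ˡ k x))) (∀ⁿE k (assume p) x)

module _ {m Δ k} {Γ : List (Fm m Δ)} {jA : Fin 2} {R : SVar Δ 2} {B X : SVar Δ k}
         (isPre : IsPreimage k jA R B X ∈ Γ) where

  isPreimage-at-bv : List.map (wkFⁿ k) Γ ⊢ IsPreimage-at jA R B X bv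
  isPreimage-at-bv = openⁿ k (assume (∈-wkFⁿ k isPre))

  preimage-SubN : Γ ⊢ SubNVar jA k X
  preimage-SubN =
    ∀ⁿI k (⇒I (cast (sym (⋀map≡andF (N jA) bv)) (∧E₁ (⇒E (∧E₁ (weaken₁ isPreimage-at-bv)) assume₀))))

  preimage-carried : Γ ⊢ Carries k R X B
  preimage-carried = ∀ⁿI k (cut isPreimage-at-bv (∀ⁿI k (⇒I (⇒I (⇒E imagesIn (assume (there (here refl))))))))
    where
      x : Fin k → Tm (k + (k + m))
      x i = wkTⁿ k (bv {m = m} i)
      Γ' : List (Fm (k + (k + m)) Δ)
      Γ' = sappF X x ∷ andF (λ i → sapp₂ R (x i) (bv i))
             ∷ List.map (wkFⁿ k) (IsPreimage-at jA R B X bv ∷ List.map (wkFⁿ k) Γ)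
      isPre-x : Γ' ⊢ IsPreimage-at jA R B X x
      isPre-x = weaken₁ (weaken₁ (cast (substF-IsPreimage-at jA R B X bv (wkⁿσ k)) (assume (∈-wkFⁿ k (here refl)))))
      imagesIn : Γ' ⊢ andF (λ i → sapp₂ R (x i) (bv i)) ⇒ sappF B bv
      imagesIn = cast (ImagesInBody-inst R B x bv) (∀ⁿE k (∧E₂ (⇒E (∧E₁ isPre-x) assume₀)) bv)

  preimage-carries-back : ∀ {R'} → RangeIn jA R' ∈ Γ → RetractionOf R R' ∈ Γ → Γ ⊢ Carries k R' B X
  preimage-carries-back {R'} range retr = ∀ⁿI k (∀ⁿI k (⇒I (⇒I (⇒E (∧E₂ isPre-x) (∧I x∈N imagesIn)))))
    where
      y : Fin k → Tm (k + (k + m))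
      y i = wkTⁿ k (bv {m = m} i)
      x : Fin k → Tm (k + (k + m))
      x = bv
      Γ' : List (Fm (k + (k + m)) Δ)
      Γ' = sappF B y ∷ andF (λ i → sapp₂ R' (y i) (x i)) ∷ List.map (wkFⁿ k) (List.map (wkFⁿ k) Γ)
      lift : ∀ {φ} → φ ∈ Γ → wkFⁿ k (wkFⁿ k φ) ∈ Γ'
      lift p = there (there (∈-wkFⁿ k (∈-wkFⁿ k p)))
      isPre-x : Γ' ⊢ IsPreimage-at jA R B X x
      isPre-x = IsPreimage-inst (subst (_∈ Γ') (trans (cong (wkFⁿ k) (substF-IsPreimage k jA R B X (wkⁿσ k)))
                                                       (substF-IsPreimage k jA R B X (wkⁿσ k))) (lift isPre)) x
      x∈N : Γ' ⊢ andF (λ i → N jA (x i))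
      x∈N = andI k (λ i → ⇒E (∀E₂ (assume (lift range)) (y i) (x i)) (andE k (assume (there (here refl))) i))
      y' x' : Fin k → Tm (k + (k + (k + m)))
      y' i = wkTⁿ k (y i)
      x' i = wkTⁿ k (x i)
      Γ'' : List (Fm (k + (k + (k + m))) Δ)
      Γ'' = andF (λ i → sapp₂ R (x' i) (bv i)) ∷ List.map (wkFⁿ k) Γ'
      R'y'x' : Γ'' ⊢ andF (λ i → sapp₂ R' (y' i) (x' i))
      R'y'x' = cast (substF-andF k _ _) (assume (there (∈-wkFⁿ k (there (here refl)))))
      By' : Γ'' ⊢ sappF B y'
      By' = cast (substF-sappF B y _) (assume (there (∈-wkFⁿ k (here refl))))
      y'≐bv : Γ'' ⊢ andF (λ i → y' i ≐ bv i)
      y'≐bv = andI k (λ i → ⇒E (⇒E (∀E₃ (assume (there (∈-wkFⁿ k (lift retr)))) (y' i) (x' i) (bv i))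
                                     (andE k R'y'x' i))
                                 (andE k assume₀ i))
      imagesIn : Γ' ⊢ ∀ⁿ k (ImagesInBody R B x)
      imagesIn = ∀ⁿI k (⇒I (≐subst-sappF B y' bv y'≐bv By'))

-- The preimage X = {x̄ ∈ N_A : ∀ȳ (R x̄ ȳ → B ȳ)} exists by comprehension.
preimage-exists : ∀ k {m Δ} {Γ : List (Fm m Δ)} jA {R R' : SVar Δ 2} (B : SVar Δ k) {C : Fm m Δ} →
                  RangeIn jA R' ∈ Γ → RetractionOf R R' ∈ Γ →
                  (SubNVar jA k here ∷ Carries k (there R) here (there B) ∷ Carries k (there R') (there B) here
                     ∷ List.map wkS Γ) ⊢ wkS C →
                  Γ ⊢ C
preimage-exists k {m} {Δ} {Γ} jA {R} {R'} B range retr cont =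
  ∃²E (comp k (Preimage jA R B bv))
      (cut (preimage-SubN {k = k} isPre) (cut (weaken₁ (preimage-carried {k = k} isPre))
        (cut (weaken₁ (weaken₁ (preimage-carries-back {k = k} isPre (lift range) (lift retr)))) (weaken reorder cont))))
  where
    preimageComprehension : Fm m (k ∷ Δ)
    preimageComprehension = ∀ⁿ k (sapp here (vars k m) ⇔ wkS (Preimage jA R B (bv {m = m})))
    Γ₀ : List (Fm m (k ∷ Δ))
    Γ₀ = preimageComprehension ∷ List.map wkS Γ
    isPre : IsPreimage k jA (there R) (there B) here ∈ Γ₀
    isPre = subst (_∈ Γ₀)
      (cong (∀ⁿ k) (cong (λ z → (sapp here (vars k m) ⇒ z) ∧' (z ⇒ sapp here (vars k m))) (renS-Preimage jA R B bv there)))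
      (here refl)
    lift : ∀ {φ} → φ ∈ Γ → wkS φ ∈ Γ₀
    lift p = there (∈-wkS p)
    reorder : ∀ {a b c d} {Γ' : List (Fm m (k ∷ Δ))} → (a ∷ b ∷ c ∷ Γ') ⊆ (c ∷ b ∷ a ∷ d ∷ Γ')
    reorder (here p) = there (there (here p))
    reorder (there (here p)) = there (here p)
    reorder (there (there (here p))) = here p
    reorder (there (there (there p))) = there (there (there (there p)))

RelZero : ∀ {n Δ} → Fin 2 → Fin 2 → SVar Δ 2 → Fm n Δ
RelZero j1 j2 R = sapp₂ R (con j1) (con j2)

RelSucc : ∀ {n Δ} → Fin 2 → Fin 2 → SVar Δ 2 → Fm n Δ
RelSucc j1 j2 R = ∀' (∀' (sapp₂ R v1 v0 ⇒ sapp₂ R (app j1 v1) (app j2 v0)))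

Total : ∀ {n Δ} → Fin 2 → Fin 2 → SVar Δ 2 → SVar Δ 2 → Fm n Δ
Total j1 j2 R R' = ∀' (N j1 v0 ⇒ ∃' (N j2 v0 ∧' sapp₂ R v1 v0 ∧' sapp₂ R' v0 v1))

Functional : ∀ {n Δ} → SVar Δ 2 → Fm n Δ
Functional R = ∀' (∀' (∀' (sapp₂ R v2 v1 ⇒ sapp₂ R v2 v0 ⇒ v1 ≐ v0)))

DomainIn : ∀ {n Δ} → Fin 2 → SVar Δ 2 → Fm n Δ
DomainIn j R = ∀' (∀' (sapp₂ R v1 v0 ⇒ N j v1))

ConverseIn : ∀ {n Δ} → SVar Δ 2 → SVar Δ 2 → Fm n Δ
ConverseIn R R' = ∀' (∀' (sapp₂ R v1 v0 ⇒ sapp₂ R' v0 v1))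

record IsoFacts {m Δ} (Γ : List (Fm m Δ)) (j1 j2 : Fin 2) (R R' : SVar Δ 2) : Set where
  field
    rel-zero    : RelZero j1 j2 R ∈ Γ
    rel-succ    : RelSucc j1 j2 R ∈ Γ
    total       : Total j1 j2 R R' ∈ Γ
    functional  : Functional R ∈ Γ
    domain      : DomainIn j1 R ∈ Γ
    converse    : ConverseIn R R' ∈ Γ
    rel-zero⁻   : RelZero j2 j1 R' ∈ Γ
    rel-succ⁻   : RelSucc j2 j1 R' ∈ Γ
    total⁻      : Total j2 j1 R' R ∈ Γ
    functional⁻ : Functional R' ∈ Γ
    domain⁻     : DomainIn j2 R' ∈ Γ
    converse⁻   : ConverseIn R' R ∈ Γ
open IsoFacts

IsoFacts-flip : ∀ {m Δ} {Γ : List (Fm m Δ)} {j1 j2 R R'} → IsoFacts Γ j1 j2 R R' → IsoFacts Γ j2 j1 R' R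
IsoFacts-flip F = record
  { rel-zero = rel-zero⁻ F ; rel-succ = rel-succ⁻ F ; total = total⁻ F
  ; functional = functional⁻ F ; domain = domain⁻ F ; converse = converse⁻ F
  ; rel-zero⁻ = rel-zero F ; rel-succ⁻ = rel-succ F ; total⁻ = total F
  ; functional⁻ = functional F ; domain⁻ = domain F ; converse⁻ = converse F }

IsoFacts-⊆ : ∀ {m Δ} {Γ Γ' : List (Fm m Δ)} {j1 j2 R R'} → Γ ⊆ Γ' → IsoFacts Γ j1 j2 R R' → IsoFacts Γ' j1 j2 R R'
IsoFacts-⊆ s F = record
  { rel-zero = s (rel-zero F) ; rel-succ = s (rel-succ F) ; total = s (total F)
  ; functional = s (functional F) ; domain = s (domain F) ; converse = s (converse F)
  ; rel-zero⁻ = s (rel-zero⁻ F) ; rel-succ⁻ = s (rel-succ⁻ F) ; total⁻ = s (total⁻ F)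
  ; functional⁻ = s (functional⁻ F) ; domain⁻ = s (domain⁻ F) ; converse⁻ = s (converse⁻ F) }

IsoFacts-wkF : ∀ {m Δ} {Γ : List (Fm m Δ)} {j1 j2 R R'} → IsoFacts Γ j1 j2 R R' → IsoFacts (List.map wkF Γ) j1 j2 R R'
IsoFacts-wkF F = record
  { rel-zero = ∈-wkF (rel-zero F) ; rel-succ = ∈-wkF (rel-succ F) ; total = ∈-wkF (total F)
  ; functional = ∈-wkF (functional F) ; domain = ∈-wkF (domain F) ; converse = ∈-wkF (converse F)
  ; rel-zero⁻ = ∈-wkF (rel-zero⁻ F) ; rel-succ⁻ = ∈-wkF (rel-succ⁻ F) ; total⁻ = ∈-wkF (total⁻ F)
  ; functional⁻ = ∈-wkF (functional⁻ F) ; domain⁻ = ∈-wkF (domain⁻ F) ; converse⁻ = ∈-wkF (converse⁻ F) }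

IsoFacts-wkS : ∀ {m Δ k} {Γ : List (Fm m Δ)} {j1 j2 R R'} → IsoFacts Γ j1 j2 R R' →
               IsoFacts (List.map (wkS {j = k}) Γ) j1 j2 (there R) (there R')
IsoFacts-wkS F = record
  { rel-zero = ∈-wkS (rel-zero F) ; rel-succ = ∈-wkS (rel-succ F) ; total = ∈-wkS (total F)
  ; functional = ∈-wkS (functional F) ; domain = ∈-wkS (domain F) ; converse = ∈-wkS (converse F)
  ; rel-zero⁻ = ∈-wkS (rel-zero⁻ F) ; rel-succ⁻ = ∈-wkS (rel-succ⁻ F) ; total⁻ = ∈-wkS (total⁻ F)
  ; functional⁻ = ∈-wkS (functional⁻ F) ; domain⁻ = ∈-wkS (domain⁻ F) ; converse⁻ = ∈-wkS (converse⁻ F) }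

module _ {m Δ} {Γ : List (Fm m Δ)} {j1 j2 : Fin 2} {R R' : SVar Δ 2} (F : IsoFacts Γ j1 j2 R R') where

  converse-range : Γ ⊢ RangeIn j1 R'
  converse-range = ∀I (∀I (⇒I (⇒E (∀E₂ (assume (there (∈-wkF² (domain F)))) v0 v1)
                                  (⇒E (∀E₂ (assume (there (∈-wkF² (converse⁻ F)))) v1 v0) assume₀))))

  converse-retraction : Γ ⊢ RetractionOf R R'
  converse-retraction =
    ∀I (∀I (∀I (⇒I (⇒I (⇒E (⇒E (∀E₃ (assume (there (there (∈-wkF (∈-wkF² (functional F)))))) v1 v2 v0)
                                   (⇒E (∀E₂ (assume (there (there (∈-wkF (∈-wkF² (converse⁻ F)))))) v2 v1)
                                       (assume (there (here refl)))))
                               assume₀)))))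

-- Transfer of relativised formulas along an isomorphism

relativize : ∀ {n Δ m Δ'} → Fin 2 → (Fin n → Tm m) → Ren Δ Δ' → Formula Arith n Δ → Fm m Δ'
relativize j σ ρ φ = renS (substF (relF j φ) σ) ρ

substF-relativize : ∀ {n Δ m m' Δ'} j (σ : Fin n → Tm m) (ρ : Ren Δ Δ') (φ : Formula Arith n Δ) (τ : Fin m → Tm m') →
                    substF (relativize j σ ρ φ) τ ≡ relativize j (σ ⊙ τ) ρ φ
substF-relativize j σ ρ φ τ =
  trans (sym (renS-substF (substF (relF j φ) σ) τ ρ)) (cong (λ z → renS z ρ) (substF-comp (relF j φ) σ τ))

renS-relativize : ∀ {n Δ m Δ' Δ''} j (σ : Fin n → Tm m) (ρ : Ren Δ Δ') (φ : Formula Arith n Δ) (ρ' : Ren Δ' Δ'') →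
                  renS (relativize j σ ρ φ) ρ' ≡ relativize j σ (ρ' ∘ ρ) φ
renS-relativize j σ ρ φ ρ' = renS-comp (substF (relF j φ) σ) ρ ρ'

relativize-cong : ∀ {n Δ m Δ'} j {σ σ' : Fin n → Tm m} {ρ ρ' : Ren Δ Δ'} (φ : Formula Arith n Δ) →
                  (∀ i → σ i ≡ σ' i) → (∀ {k} (v : SVar Δ k) → ρ v ≡ ρ' v) → relativize j σ ρ φ ≡ relativize j σ' ρ' φ
relativize-cong j {σ' = σ'} {ρ} φ eσ eρ =
  trans (cong (λ z → renS z ρ) (substF-cong (relF j φ) eσ)) (renS-cong (substF (relF j φ) σ') eρ)

wk²σ : ∀ {n m} → (Fin n → Tm m) → Fin n → Tm (suc (suc m))
wk²σ σ = (σ ⊙ wkσ) ⊙ wkσ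

wkF-relativize-liftσ : ∀ {n Δ m Δ'} j (σ : Fin n → Tm m) (ρ : Ren Δ Δ') (φ : Formula Arith (suc n) Δ) →
                       wkF (relativize j (liftσ σ) ρ φ) ≡ relativize j (v1 ∷σ wk²σ σ) ρ φ
wkF-relativize-liftσ j σ ρ φ =
  trans (substF-relativize j (liftσ σ) ρ φ wkσ) (relativize-cong j φ (λ { zero → refl ; (suc i) → refl }) (λ v → refl))

relativize-liftσ-at-v0 : ∀ {n Δ m Δ'} j (σ : Fin n → Tm m) (ρ : Ren Δ Δ') (φ : Formula Arith (suc n) Δ) →
                         substF (substF (substF (relativize j (liftσ σ) ρ φ) (liftσ wkσ)) (liftσ wkσ)) (instσ v0)
                         ≡ relativize j (v0 ∷σ wk²σ σ) ρ φ
relativize-liftσ-at-v0 j σ ρ φ =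
  trans (cong (λ z → substF z (instσ v0))
              (trans (cong (λ z → substF z (liftσ wkσ)) (substF-relativize j (liftσ σ) ρ φ (liftσ wkσ)))
                     (substF-relativize j _ ρ φ (liftσ wkσ))))
  (trans (substF-relativize j _ ρ φ (instσ v0)) (relativize-cong j φ pointwise (λ v → refl)))
  where
    pointwise : ∀ i → (((liftσ σ ⊙ liftσ wkσ) ⊙ liftσ wkσ) ⊙ instσ v0) i ≡ (v0 ∷σ wk²σ σ) i
    pointwise zero = refl
    pointwise (suc i) =
      trans (substT-comp (substT (wkT (σ i)) (liftσ wkσ)) (liftσ wkσ) (instσ v0))
      (trans (substT-comp (wkT (σ i)) (liftσ wkσ) (liftσ wkσ ⊙ instσ v0))
      (trans (substT-comp (σ i) wkσ _) (sym (substT-comp (σ i) wkσ wkσ))))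

renS³ : ∀ {n Δ₀ Δ₁ Δ₂ Δ₃} (φ : Fm n Δ₀) (a : Ren Δ₀ Δ₁) (b : Ren Δ₁ Δ₂) (c : Ren Δ₂ Δ₃) →
        renS (renS (renS φ a) b) c ≡ renS φ (c ∘ b ∘ a)
renS³ φ a b c = trans (cong (λ z → renS z c) (renS-comp φ a b)) (renS-comp φ _ c)

renS-SubNVar : ∀ {n Δ Δ'} j k (X : SVar Δ k) (ρ : Ren Δ Δ') → renS (SubNVar {n} j k X) ρ ≡ SubNVar j k (ρ X)
renS-SubNVar j k X ρ =
  trans (renS-∀ⁿ k _ ρ) (cong (∀ⁿ k) (cong (_ ⇒_)
    (trans (cong (λ z → renS z ρ) (⋀map≡andF (N j) bv)) (trans (renS-andF k _ ρ) (sym (⋀map≡andF (N j) bv))))))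

substF-SubN : ∀ {n m Δ} j k (σ : Fin n → Tm m) → substF (SubN {n} {Δ} j k) σ ≡ SubNVar j k here
substF-SubN j k σ =
  trans (substF-∀ⁿ k _ σ) (cong (∀ⁿ k) (cong₂ _⇒_
    (trans (substF-sappF here bv (liftⁿ k σ)) (sappF-cong here (liftⁿ-↑ˡ k σ)))
    (trans (cong (λ z → substF z (liftⁿ k σ)) (⋀map≡andF (N j) bv))
      (trans (substF-andF k _ _) (trans (andF-cong k (λ i → cong (N j) (liftⁿ-↑ˡ k σ i))) (sym (⋀map≡andF (N j) bv)))))))

renS-substF-SubN : ∀ {n m Δ Δ'} j k (σ : Fin n → Tm m) (ρ : Ren (k ∷ Δ) Δ') →
                   renS (substF (SubN {n} {Δ} j k) σ) ρ ≡ SubNVar j k (ρ here)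
renS-substF-SubN j k σ ρ = trans (cong (λ z → renS z ρ) (substF-SubN j k σ)) (renS-SubNVar j k here ρ)

record Related {n Δ m Δ'} (Γ : List (Fm m Δ')) (j1 j2 : Fin 2) (R R' : SVar Δ' 2)
               (σ1 σ2 : Fin n → Tm m) (ρ1 ρ2 : Ren Δ Δ') : Set where
  field
    isoFacts : IsoFacts Γ j1 j2 R R'
    terms    : ∀ i → sapp₂ R (σ1 i) (σ2 i) ∈ Γ
    terms⁻   : ∀ i → sapp₂ R' (σ2 i) (σ1 i) ∈ Γ
    rels     : ∀ {k} (X : SVar Δ k) → Carries k R (ρ1 X) (ρ2 X) ∈ Γ
    rels⁻    : ∀ {k} (X : SVar Δ k) → Carries k R' (ρ2 X) (ρ1 X) ∈ Γ
open Related

module _ {n Δ m Δ'} {Γ : List (Fm m Δ')} {j1 j2 : Fin 2} {R R' : SVar Δ' 2} {σ1 σ2 : Fin n → Tm m} {ρ1 ρ2 : Ren Δ Δ'} where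

  Related-flip : Related Γ j1 j2 R R' σ1 σ2 ρ1 ρ2 → Related Γ j2 j1 R' R σ2 σ1 ρ2 ρ1
  Related-flip H = record { isoFacts = IsoFacts-flip (isoFacts H) ; terms = terms⁻ H ; terms⁻ = terms H
                          ; rels = rels⁻ H ; rels⁻ = rels H }

  Related-⊆ : ∀ {Γ'} → Γ ⊆ Γ' → Related Γ j1 j2 R R' σ1 σ2 ρ1 ρ2 → Related Γ' j1 j2 R R' σ1 σ2 ρ1 ρ2
  Related-⊆ s H = record { isoFacts = IsoFacts-⊆ s (isoFacts H) ; terms = s ∘ terms H ; terms⁻ = s ∘ terms⁻ H
                         ; rels = λ X → s (rels H X) ; rels⁻ = λ X → s (rels⁻ H X) }

  Related-wkF : Related Γ j1 j2 R R' σ1 σ2 ρ1 ρ2 → Related (List.map wkF Γ) j1 j2 R R' (σ1 ⊙ wkσ) (σ2 ⊙ wkσ) ρ1 ρ2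
  Related-wkF H = record
    { isoFacts = IsoFacts-wkF (isoFacts H) ; terms = ∈-wkF ∘ terms H ; terms⁻ = ∈-wkF ∘ terms⁻ H
    ; rels = λ {k} X → subst (_∈ _) (substF-Carries k R _ _ wkσ) (∈-wkF (rels H X))
    ; rels⁻ = λ {k} X → subst (_∈ _) (substF-Carries k R' _ _ wkσ) (∈-wkF (rels⁻ H X)) }

  Related-bind : ∀ {t s} → Related Γ j1 j2 R R' σ1 σ2 ρ1 ρ2 → sapp₂ R t s ∈ Γ → sapp₂ R' s t ∈ Γ →
                 Related Γ j1 j2 R R' (t ∷σ σ1) (s ∷σ σ2) ρ1 ρ2
  Related-bind H p p⁻ = record
    { isoFacts = isoFacts H
    ; terms = λ { zero → p ; (suc i) → terms H i } ; terms⁻ = λ { zero → p⁻ ; (suc i) → terms⁻ H i }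
    ; rels = rels H ; rels⁻ = rels⁻ H }

  Related-wkS : ∀ {k} → Related Γ j1 j2 R R' σ1 σ2 ρ1 ρ2 →
                Related (List.map (wkS {j = k}) Γ) j1 j2 (there R) (there R') σ1 σ2 (there ∘ ρ1) (there ∘ ρ2)
  Related-wkS H = record
    { isoFacts = IsoFacts-wkS (isoFacts H) ; terms = ∈-wkS ∘ terms H ; terms⁻ = ∈-wkS ∘ terms⁻ H
    ; rels = λ {k} X → subst (_∈ _) (renS-Carries k R _ _ there) (∈-wkS (rels H X))
    ; rels⁻ = λ {k} X → subst (_∈ _) (renS-Carries k R' _ _ there) (∈-wkS (rels⁻ H X)) }

  Related-bindS : ∀ {k} {A B : SVar Δ' k} → Related Γ j1 j2 R R' σ1 σ2 ρ1 ρ2 →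
                  Carries k R A B ∈ Γ → Carries k R' B A ∈ Γ → Related Γ j1 j2 R R' σ1 σ2 (A ∷ρ ρ1) (B ∷ρ ρ2)
  Related-bindS H p p⁻ = record
    { isoFacts = isoFacts H ; terms = terms H ; terms⁻ = terms⁻ H
    ; rels = λ { here → p ; (there v) → rels H v } ; rels⁻ = λ { here → p⁻ ; (there v) → rels⁻ H v } }

  related-terms : Related Γ j1 j2 R R' σ1 σ2 ρ1 ρ2 → (t : Term Arith n) →
                  Γ ⊢ sapp₂ R (substT (relT j1 t) σ1) (substT (relT j2 t) σ2)
  related-terms H (var i) = assume (terms H i)
  related-terms H (con c) = assume (rel-zero (isoFacts H))
  related-terms H (app f t) = ⇒E (∀E₂ (assume (rel-succ (isoFacts H))) _ _) (related-terms H t)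

module _ {m Δ} {Γ : List (Fm m Δ)} where

  ⇒-mono : ∀ {A₁ A₂ B₁ B₂} → Γ ⊢ A₂ ⇒ A₁ → Γ ⊢ B₁ ⇒ B₂ → Γ ⊢ (A₁ ⇒ B₁) ⇒ (A₂ ⇒ B₂)
  ⇒-mono dA dB = ⇒I (⇒I (⇒E (weaken₁ (weaken₁ dB)) (⇒E (assume (there (here refl))) (⇒E (weaken₁ (weaken₁ dA)) assume₀))))

  ∧-mono : ∀ {A₁ A₂ B₁ B₂} → Γ ⊢ A₁ ⇒ A₂ → Γ ⊢ B₁ ⇒ B₂ → Γ ⊢ (A₁ ∧' B₁) ⇒ (A₂ ∧' B₂)
  ∧-mono dA dB = ⇒I (∧I (⇒E (weaken₁ dA) (∧E₁ assume₀)) (⇒E (weaken₁ dB) (∧E₂ assume₀)))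

  ∨-mono : ∀ {A₁ A₂ B₁ B₂} → Γ ⊢ A₁ ⇒ A₂ → Γ ⊢ B₁ ⇒ B₂ → Γ ⊢ (A₁ ∨' B₁) ⇒ (A₂ ∨' B₂)
  ∨-mono dA dB = ⇒I (∨E assume₀ (∨I₁ (⇒E (weaken₁ (weaken₁ dA)) assume₀)) (∨I₂ (⇒E (weaken₁ (weaken₁ dB)) assume₀)))

  ∧-unpack₃ : ∀ {A B C D} → (C ∷ B ∷ A ∷ (A ∧' B ∧' C) ∷ Γ) ⊢ D → ((A ∧' B ∧' C) ∷ Γ) ⊢ D
  ∧-unpack₃ d = cut (∧E₁ assume₀) (cut (∧E₁ (∧E₂ (weaken₁ assume₀))) (cut (∧E₂ (∧E₂ (weaken₁ (weaken₁ assume₀)))) d))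

  ≐subst-sapp₂ˡ : ∀ (R : SVar Δ 2) {t s : Tm m} (u : Tm m) → Γ ⊢ t ≐ s → Γ ⊢ sapp₂ R t u → Γ ⊢ sapp₂ R s u
  ≐subst-sapp₂ˡ R {t} {s} u e d = cast (instAt s) (≐subst φ e (cast (sym (instAt t)) d))
    where
      φ : Fm (suc m) Δ
      φ = sapp₂ R v0 (wkT u)
      instAt : ∀ c → inst φ c ≡ sapp₂ R c u
      instAt c = trans (inst≡substF φ c) (cong (sapp₂ R c) (wkT-instσ u c))

transfer : ∀ {n Δ} (φ : Formula Arith n Δ) {m Δ'} {Γ : List (Fm m Δ')} {j1 j2 R R'}
           {σ1 σ2 : Fin n → Tm m} {ρ1 ρ2 : Ren Δ Δ'} →
           Related Γ j1 j2 R R' σ1 σ2 ρ1 ρ2 → Γ ⊢ relativize j1 σ1 ρ1 φ ⇒ relativize j2 σ2 ρ2 φ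
transfer (t ≐ s) H =
  ⇒I (⇒E (⇒E (∀E₃ (assume (functional (isoFacts H'))) _ _ _) (≐subst-sapp₂ˡ _ _ assume₀ (related-terms H' t)))
         (related-terms H' s))
  where H' = Related-⊆ there H
transfer (prd () t) H
transfer (sapp {k = k} X ts) {m} {Γ = Γ} {j1} {j2} {R} {σ1 = σ1} {σ2} {ρ1} {ρ2} H =
  ⇒I (cast (sappF-lookup u₂) (⇒E (⇒E (weaken₁ carried) (andI k related)) (cast (sym (sappF-lookup u₁)) assume₀)))
  where
    u₁ u₂ : Vec (Tm m) k
    u₁ = map (λ t → substT t σ1) (map (relT j1) ts)
    u₂ = map (λ t → substT t σ2) (map (relT j2) ts)
    sappF-lookup : ∀ {Y} (u : Vec (Tm _) k) → sappF Y (lookup u) ≡ sapp Y u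
    sappF-lookup {Y} u = cong (sapp Y) (VecP.tabulate∘lookup u)
    carried : Γ ⊢ Carries-at R (ρ1 X) (ρ2 X) (lookup u₁) (lookup u₂)
    carried = Carries-inst (assume (rels H X)) (lookup u₁) (lookup u₂)
    lookup-u : ∀ j (σ : _ → Tm _) i → lookup (map (λ t → substT t σ) (map (relT j) ts)) i ≡ substT (relT j (lookup ts i)) σ
    lookup-u j σ i = trans (VecP.lookup-map i (λ t → substT t σ) (map (relT j) ts))
                           (cong (λ t → substT t σ) (VecP.lookup-map i (relT j) ts))
    related : ∀ i → (sapp (ρ1 X) u₁ ∷ Γ) ⊢ sapp₂ R (lookup u₁ i) (lookup u₂ i)
    related i = cast (sym (cong₂ (sapp₂ R) (lookup-u j1 σ1 i) (lookup-u j2 σ2 i))) (related-terms (Related-⊆ there H) (lookup ts i))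
transfer ⊥' H = ⇒I assume₀
transfer (φ ⇒ ψ) H = ⇒-mono (transfer φ (Related-flip H)) (transfer ψ H)
transfer (φ ∧' ψ) H = ∧-mono (transfer φ H) (transfer ψ H)
transfer (φ ∨' ψ) H = ∨-mono (transfer φ H) (transfer ψ H)
transfer (∀' φ) {m} {Δ'} {Γ} {j1} {j2} {R} {R'} {σ1} {σ2} {ρ1} {ρ2} H =
  ⇒I (∀I (⇒I (∃E (⇒E (∀E-substF (assume total⁻-b) v0) assume₀) (∧-unpack₃ conclusion))))
  where
    hyp : Fm m Δ'
    hyp = ∀' (N j1 v0 ⇒ relativize j1 (liftσ σ1) ρ1 φ)
    Γb : List (Fm (suc m) Δ')
    Γb = N j2 v0 ∷ List.map wkF (hyp ∷ Γ)
    total⁻-b : Total j2 j1 R' R ∈ Γb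
    total⁻-b = there (∈-wkF {Γ = hyp ∷ Γ} (there (total⁻ (isoFacts H))))
    Γd : List (Fm (suc (suc m)) Δ')
    Γd = sapp₂ R v0 v1 ∷ sapp₂ R' v1 v0 ∷ N j1 v0 ∷ (N j1 v0 ∧' sapp₂ R' v1 v0 ∧' sapp₂ R v0 v1) ∷ List.map wkF Γb
    Hd : Related Γd j1 j2 R R' (v0 ∷σ wk²σ σ1) (v1 ∷σ wk²σ σ2) ρ1 ρ2
    Hd = Related-bind (Related-⊆ (λ p → there (there (there (there p)))) (Related-wkF (Related-⊆ there (Related-wkF (Related-⊆ (there {x = hyp}) H)))))
                      (here refl) (there (here refl))
    hypAt : Γd ⊢ N j1 v0 ⇒ relativize j1 (v0 ∷σ wk²σ σ1) ρ1 φ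
    hypAt = cast (cong (N j1 v0 ⇒_) (relativize-liftσ-at-v0 j1 σ1 ρ1 φ))
                 (∀E-substF (assume (there (there (there (there (∈-wkF {Γ = Γb} (there (∈-wkF {Γ = hyp ∷ Γ} (here refl))))))))) v0)
    conclusion : Γd ⊢ wkF (relativize j2 (liftσ σ2) ρ2 φ)
    conclusion = cast (sym (wkF-relativize-liftσ j2 σ2 ρ2 φ))
                      (⇒E (transfer φ Hd) (⇒E hypAt (assume (there (there (here refl))))))
transfer (∃' φ) {m} {Δ'} {Γ} {j1} {j2} {R} {R'} {σ1} {σ2} {ρ1} {ρ2} H =
  ⇒I (∃E assume₀ (∃E (⇒E (∀E-substF (assume total-a) v0) (∧E₁ assume₀)) (∧-unpack₃ conclusion)))
  where
    A B : Fm (suc m) Δ'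
    A = relativize j1 (liftσ σ1) ρ1 φ
    B = relativize j2 (liftσ σ2) ρ2 φ
    hyp : Fm m Δ'
    hyp = ∃' (N j1 v0 ∧' A)
    Γa : List (Fm (suc m) Δ')
    Γa = (N j1 v0 ∧' A) ∷ List.map wkF (hyp ∷ Γ)
    total-a : Total j1 j2 R R' ∈ Γa
    total-a = there (∈-wkF {Γ = hyp ∷ Γ} (there (total (isoFacts H))))
    Γc : List (Fm (suc (suc m)) Δ')
    Γc = sapp₂ R' v0 v1 ∷ sapp₂ R v1 v0 ∷ N j2 v0 ∷ (N j2 v0 ∧' sapp₂ R v1 v0 ∧' sapp₂ R' v0 v1) ∷ List.map wkF Γa
    Hc : Related Γc j1 j2 R R' (v1 ∷σ wk²σ σ1) (v0 ∷σ wk²σ σ2) ρ1 ρ2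
    Hc = Related-bind (Related-⊆ (λ p → there (there (there (there p)))) (Related-wkF (Related-⊆ there (Related-wkF (Related-⊆ (there {x = hyp}) H)))))
                      (there (here refl)) (here refl)
    premise : Γc ⊢ relativize j1 (v1 ∷σ wk²σ σ1) ρ1 φ
    premise = cast (wkF-relativize-liftσ j1 σ1 ρ1 φ) (∧E₂ (assume (there (there (there (there (∈-wkF {Γ = Γa} (here refl))))))))
    conclusion : Γc ⊢ wkF (wkF (∃' (N j2 v0 ∧' B)))
    conclusion =
      ∃I v0 (cast (sym (inst≡substF (N j2 v0 ∧' substF (substF B (liftσ wkσ)) (liftσ wkσ)) v0))
                  (∧I (assume (there (there (here refl))))
                      (cast (sym (relativize-liftσ-at-v0 j2 σ2 ρ2 φ)) (⇒E (transfer φ Hc) premise))))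
transfer (∀² k φ) {m} {Δ'} {Γ} {j1} {j2} {R} {R'} {σ1} {σ2} {ρ1} {ρ2} H = ⇒I (∀²I (⇒I conclusion))
  where
    A B : Fm m (k ∷ Δ')
    A = relativize j1 σ1 (liftρ ρ1) φ
    B = relativize j2 σ2 (liftρ ρ2) φ
    S₁ : Fm m (k ∷ Δ')
    S₁ = renS (substF (SubN j1 k) σ1) (liftρ ρ1)
    hyp : Fm m Δ'
    hyp = ∀² k (S₁ ⇒ A)
    Γa : List (Fm m (k ∷ Δ'))
    Γa = renS (substF (SubN j2 k) σ2) (liftρ ρ2) ∷ List.map wkS (hyp ∷ Γ)
    Fa : IsoFacts Γa j1 j2 (there R) (there R')
    Fa = IsoFacts-⊆ there (IsoFacts-wkS (IsoFacts-⊆ there (isoFacts H)))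
    Γa' : List (Fm m (k ∷ Δ'))
    Γa' = RetractionOf (there R) (there R') ∷ RangeIn j1 (there R') ∷ Γa
    Γc : List (Fm m (k ∷ k ∷ Δ'))
    Γc = SubNVar j1 k here ∷ Carries k (there (there R)) here (there here)
           ∷ Carries k (there (there R')) (there here) here ∷ List.map wkS Γa'
    ρ1' ρ2' : Ren (k ∷ _) (k ∷ k ∷ Δ')
    ρ1' = here ∷ρ (λ v → there (there (ρ1 v)))
    ρ2' = there here ∷ρ (λ v → there (there (ρ2 v)))
    Hc : Related Γc j1 j2 (there (there R)) (there (there R')) σ1 σ2 ρ1' ρ2'
    Hc = Related-bindS (Related-⊆ (λ p → there (there (there p))) (Related-wkS (Related-⊆ (λ p → there (there (there p)))
                         (Related-wkS (Related-⊆ (there {x = hyp}) H)))))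
                       (there (here refl)) (there (there (here refl)))
    wk : ∀ {Δ₀} → Ren (k ∷ Δ₀) (k ∷ k ∷ Δ₀)
    wk = liftρ {L = Arith²} there
    hypAt : Γc ⊢ SubNVar j1 k here ⇒ relativize j1 σ1 ρ1' φ
    hypAt = cast (trans (instS≡renS _ here) (cong₂ _⇒_
                   (trans (renS³ S₁ wk wk (instρ here)) (trans (renS-comp (substF (SubN j1 k) σ1) (liftρ ρ1) _)
                     (renS-substF-SubN j1 k σ1 _)))
                   (trans (renS³ A wk wk (instρ here)) (trans (renS-relativize j1 σ1 (liftρ ρ1) φ _)
                     (relativize-cong j1 φ (λ _ → refl) (λ { here → refl ; (there v) → refl }))))))
              (∀²E (assume (there (there (there (∈-wkS (there (there (there (∈-wkS (here refl)))))))))) here)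
    conclusion : Γa ⊢ B
    conclusion =
      cut (converse-range Fa) (cut (weaken₁ (converse-retraction Fa))
        (preimage-exists k j1 here (there (here refl)) (here refl)
          (cast (sym (trans (renS-relativize j2 σ2 (liftρ ρ2) φ there)
                            (relativize-cong j2 φ (λ _ → refl) (λ { here → refl ; (there v) → refl }))))
                (⇒E (transfer φ Hc) (⇒E hypAt (assume (here refl)))))))
transfer (∃² k φ) {m} {Δ'} {Γ} {j1} {j2} {R} {R'} {σ1} {σ2} {ρ1} {ρ2} H = ⇒I (∃²E assume₀ conclusion)
  where
    A B : Fm m (k ∷ Δ')
    A = relativize j1 σ1 (liftρ ρ1) φ
    B = relativize j2 σ2 (liftρ ρ2) φ
    S₁ S₂ : Fm m (k ∷ Δ')
    S₁ = renS (substF (SubN j1 k) σ1) (liftρ ρ1)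
    S₂ = renS (substF (SubN j2 k) σ2) (liftρ ρ2)
    hyp : Fm m Δ'
    hyp = ∃² k (S₁ ∧' A)
    Γa : List (Fm m (k ∷ Δ'))
    Γa = (S₁ ∧' A) ∷ List.map wkS (hyp ∷ Γ)
    Fa : IsoFacts Γa j2 j1 (there R') (there R)
    Fa = IsoFacts-flip (IsoFacts-⊆ there (IsoFacts-wkS (IsoFacts-⊆ there (isoFacts H))))
    Γa' : List (Fm m (k ∷ Δ'))
    Γa' = RetractionOf (there R') (there R) ∷ RangeIn j2 (there R) ∷ Γa
    Γc : List (Fm m (k ∷ k ∷ Δ'))
    Γc = SubNVar j2 k here ∷ Carries k (there (there R')) here (there here)
           ∷ Carries k (there (there R)) (there here) here ∷ List.map wkS Γa'
    ρ1' ρ2' : Ren (k ∷ _) (k ∷ k ∷ Δ')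
    ρ1' = there here ∷ρ (λ v → there (there (ρ1 v)))
    ρ2' = here ∷ρ (λ v → there (there (ρ2 v)))
    Hc : Related Γc j1 j2 (there (there R)) (there (there R')) σ1 σ2 ρ1' ρ2'
    Hc = Related-bindS (Related-⊆ (λ p → there (there (there p))) (Related-wkS (Related-⊆ (λ p → there (there (there p)))
                         (Related-wkS (Related-⊆ (there {x = hyp}) H)))))
                       (there (there (here refl))) (there (here refl))
    premise : Γc ⊢ relativize j1 σ1 ρ1' φ
    premise = cast (trans (renS-relativize j1 σ1 _ φ _) (relativize-cong j1 φ (λ _ → refl) (λ { here → refl ; (there v) → refl })))
                   (∧E₂ (assume (there (there (there (∈-wkS (there (there (here refl)))))))))
    witness : Γc ⊢ wkS (wkS (∃² k (S₂ ∧' B)))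
    wk : ∀ {Δ₀} → Ren (k ∷ Δ₀) (k ∷ k ∷ Δ₀)
    wk = liftρ {L = Arith²} there
    witness = ∃²I here (cast (sym (trans (instS≡renS _ here) (cong₂ _∧'_
                (trans (renS³ S₂ wk wk (instρ here)) (trans (renS-comp (substF (SubN j2 k) σ2) (liftρ ρ2) _)
                  (renS-substF-SubN j2 k σ2 _)))
                (trans (renS³ B wk wk (instρ here)) (trans (renS-relativize j2 σ2 (liftρ ρ2) φ _)
                  (relativize-cong j2 φ (λ _ → refl) (λ { here → refl ; (there v) → refl })))))))
                (∧I (assume (here refl)) (⇒E (transfer φ Hc) premise)))
    conclusion : Γa ⊢ wkS (∃² k (S₂ ∧' B))
    conclusion = cut (converse-range Fa) (cut (weaken₁ (converse-retraction Fa)) (preimage-exists k j2 here (there (here refl)) (here refl) witness))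

-- Induction in each copy

X1 : ∀ {n Δ} → Tm n → Fm n (1 ∷ Δ)
X1 t = sapp here (t ∷ [])

SuccNotZero SuccInjective InductionAxiom SuccClosed : ∀ {n Δ} → Fin 2 → Fm n Δ
SuccNotZero j = ∀' (N j v0 ⇒ (app j v0 ≐ con j ⇒ ⊥'))
SuccInjective j = ∀' (N j v0 ⇒ ∀' (N j v0 ⇒ (app j v1 ≐ app j v0 ⇒ v1 ≐ v0)))
InductionAxiom j =
  ∀² 1 (SubN j 1 ⇒ ((X1 (con j) ∧' ∀' (N j v0 ⇒ (X1 v0 ⇒ X1 (app j v0)))) ⇒ ∀' (N j v0 ⇒ X1 v0)))
SuccClosed j = ∀' (N j v0 ⇒ N j (app j v0))

-- Defs.PA2rel j in an arbitrary variable context; at 0 variables the two agree definitionally.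
PArel : ∀ {n Δ} → Fin 2 → Fm n Δ
PArel j = (SuccNotZero j ∧' (SuccInjective j ∧' (InductionAxiom j ∧' ⊤'))) ∧' (N j (con j) ∧' SuccClosed j)

module _ {m Δ} {Γ : List (Fm m Δ)} {j : Fin 2} (pa : PArel j ∈ Γ) where

  succ≢zero : Γ ⊢ SuccNotZero j
  succ≢zero = ∧E₁ (∧E₁ (assume pa))

  succ-injective : Γ ⊢ SuccInjective j
  succ-injective = ∧E₁ (∧E₂ (∧E₁ (assume pa)))

  induction-axiom : Γ ⊢ InductionAxiom j
  induction-axiom = ∧E₁ (∧E₂ (∧E₂ (∧E₁ (assume pa))))

  zero∈N : Γ ⊢ N j (con j)
  zero∈N = ∧E₁ (∧E₂ (assume pa))

  succ∈N : Γ ⊢ SuccClosed j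
  succ∈N = ∧E₂ (∧E₂ (assume pa))

module _ {m Δ} {Γ : List (Fm m Δ)} where

  ≐sym : ∀ {t s : Tm m} → Γ ⊢ t ≐ s → Γ ⊢ s ≐ t
  ≐sym {t} {s} e = cast (instAt s) (≐subst φ e (cast (sym (instAt t)) (≐refl t)))
    where
      φ : Fm (suc m) Δ
      φ = v0 ≐ wkT t
      instAt : ∀ c → inst φ c ≡ (c ≐ t)
      instAt c = trans (inst≡substF φ c) (cong (c ≐_) (wkT-instσ t c))

  ≐trans : ∀ {t s u : Tm m} → Γ ⊢ t ≐ s → Γ ⊢ s ≐ u → Γ ⊢ t ≐ u
  ≐trans {t} e f = cast (instAt _) (≐subst φ f (cast (sym (instAt _)) e))
    where
      φ : Fm (suc m) Δ
      φ = wkT t ≐ v0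
      instAt : ∀ c → inst φ c ≡ (t ≐ c)
      instAt c = trans (inst≡substF φ c) (cong (_≐ c) (wkT-instσ t c))

  ≐cong : ∀ (j : Fin 2) {t s : Tm m} → Γ ⊢ t ≐ s → Γ ⊢ app j t ≐ app j s
  ≐cong j {t} e = cast (instAt _) (≐subst φ e (cast (sym (instAt t)) (≐refl (app j t))))
    where
      φ : Fm (suc m) Δ
      φ = app j (wkT t) ≐ app j v0
      instAt : ∀ c → inst φ c ≡ (app j t ≐ app j c)
      instAt c = trans (inst≡substF φ c) (cong (λ z → app j z ≐ app j c) (wkT-instσ t c))

substF-liftσ-wkσ-at-v0 : ∀ {m Δ} (A : Fm (suc m) Δ) → substF (substF A (liftσ wkσ)) (instσ v0) ≡ A
substF-liftσ-wkσ-at-v0 A = trans (substF-comp A _ _) (substF-id-pointwise A (λ { zero → refl ; (suc i) → refl }))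

atσ : ∀ {m} → Tm (suc m) → Fin (suc m) → Tm (suc m)
atσ t = t ∷σ wkσ

N-induction : ∀ {m Δ} {Γ : List (Fm m Δ)} {j : Fin 2} → PArel j ∈ Γ → (P : Fm (suc m) Δ) →
              Γ ⊢ substF P (instσ (con j)) → Γ ⊢ ∀' (N j v0 ⇒ P ⇒ substF P (atσ (app j v0))) →
              Γ ⊢ ∀' (N j v0 ⇒ P)
N-induction {m} {Δ} {Γ} {j} pa P base step = cut base (cut (weaken₁ step) (∃²E (comp 1 (N j v0 ∧' P)) body))
  where
    baseF stepF : Fm m Δ
    baseF = substF P (instσ (con j))
    stepF = ∀' (N j v0 ⇒ P ⇒ substF P (atσ (app j v0)))
    Γ₁ : List (Fm m Δ)
    Γ₁ = stepF ∷ baseF ∷ Γ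
    defX : Fm m (1 ∷ Δ)
    defX = ∀' (X1 v0 ⇔ (N j v0 ∧' wkS P))
    Γ₂ : List (Fm m (1 ∷ Δ))
    Γ₂ = defX ∷ List.map wkS Γ₁
    pa₂ : PArel j ∈ Γ₂
    pa₂ = there (∈-wkS (there (there pa)))
    X⊆N : Γ₂ ⊢ SubN j 1
    X⊆N = ∀I (⇒I (∧I (∧E₁ (⇒E (∧E₁ (∀E-substF (assume (there (∈-wkF {Γ = Γ₂} (here refl)))) v0)) assume₀)) (⇒I assume₀)))
    X-zero : Γ₂ ⊢ X1 (con j)
    X-zero = ⇒E (∧E₂ (∀E-substF (assume (here refl)) (con j)))
                (∧I (zero∈N pa₂) (cast (renS-substF P _ there) (assume (there (∈-wkS {Γ = Γ₁} (there (here refl)))))))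
    Γ₃ : List (Fm (suc m) (1 ∷ Δ))
    Γ₃ = X1 v0 ∷ N j v0 ∷ List.map wkF Γ₂
    defX₃ : Γ₃ ⊢ wkF defX
    defX₃ = assume (there (there (∈-wkF {Γ = Γ₂} (here refl))))
    P-x : Γ₃ ⊢ wkS P
    P-x = cast (substF-liftσ-wkσ-at-v0 (wkS P)) (∧E₂ (⇒E (∧E₁ (∀E-substF defX₃ v0)) assume₀))
    P-Sx : Γ₃ ⊢ wkS (substF P (atσ (app j v0)))
    P-Sx = cast (substF-liftσ-wkσ-at-v0 _)
                (⇒E (⇒E (∀E-substF (assume (there (there (∈-wkF {Γ = Γ₂} (there (∈-wkS {Γ = Γ₁} (here refl))))))) v0)
                        (assume (there (here refl))))
                    (cast (sym (substF-liftσ-wkσ-at-v0 (wkS P))) P-x))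
    Sx∈N : Γ₃ ⊢ N j (app j v0)
    Sx∈N = ⇒E (∀E-substF (succ∈N (there (there (∈-wkF pa₂)))) v0) (assume (there (here refl)))
    P-Sx≡ : wkS (substF P (atσ (app j v0))) ≡ substF (substF (wkS P) (liftσ wkσ)) (instσ (app j v0))
    P-Sx≡ = trans (renS-substF P _ there)
                  (sym (trans (substF-comp (wkS P) _ _) (substF-cong (wkS P) (λ { zero → refl ; (suc i) → refl }))))
    X-succ : Γ₂ ⊢ ∀' (N j v0 ⇒ (X1 v0 ⇒ X1 (app j v0)))
    X-succ = ∀I (⇒I (⇒I (⇒E (∧E₂ (∀E-substF defX₃ (app j v0))) (∧I Sx∈N (cast P-Sx≡ P-Sx)))))
    X-all : Fm (suc m) (1 ∷ Δ)
    X-all = N j v0 ⇒ X1 v0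
    all-in-X : Γ₂ ⊢ ∀' X-all
    all-in-X = ⇒E (⇒E (∀²E (induction-axiom pa₂) here) X⊆N) (∧I X-zero X-succ)
    body : Γ₂ ⊢ wkS (∀' (N j v0 ⇒ P))
    body = cut all-in-X (∀I (⇒I (cast (substF-liftσ-wkσ-at-v0 (wkS P))
             (∧E₂ (⇒E (∧E₁ (∀E-substF (assume (there (∈-wkF {Γ = ∀' X-all ∷ Γ₂} (there (here refl))))) v0))
                      (⇒E (∀E-substF (assume (there (∈-wkF {Γ = ∀' X-all ∷ Γ₂} (here refl)))) v0) assume₀))))))

Least : ∀ {n Δ} → Fin 2 → Fin 2 → SVar Δ 2 → Fm n Δ
Least j1 j2 R = ∀² 2 ((RelZero j1 j2 here ∧' RelSucc j1 j2 here) ⇒ ∀' (∀' (sapp₂ (there R) v1 v0 ⇒ sapp₂ here v1 v0)))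

at₂σ : ∀ {m} → Tm (suc (suc m)) → Tm (suc (suc m)) → Fin (suc (suc m)) → Tm (suc (suc m))
at₂σ t s = s ∷σ (t ∷σ (λ i → var (suc (suc i))))

succσ : ∀ {m} → Fin 2 → Fin 2 → Fin (suc (suc m)) → Tm (suc (suc m))
succσ j1 j2 = at₂σ (app j1 v1) (app j2 v0)

lift²wkσ : ∀ {m} → Fin (suc (suc m)) → Tm (suc (suc (suc m)))
lift²wkσ = liftσ (liftσ wkσ)

substF-lift²wkσ-inst : ∀ {m Δ} (P : Fm (suc (suc m)) Δ) (t s : Tm (suc (suc m))) →
                       substF (substF (substF P lift²wkσ) lift²wkσ) (instσ₂ t s) ≡ substF P (at₂σ t s)
substF-lift²wkσ-inst P t s =
  trans (cong (λ z → substF z (instσ₂ t s)) (substF-comp P _ _))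
        (trans (substF-comp P _ _) (substF-cong P (λ { zero → refl ; (suc zero) → refl ; (suc (suc i)) → refl })))

R-induction : ∀ {m Δ} {Γ : List (Fm m Δ)} {j1 j2 : Fin 2} {R : SVar Δ 2} → Least j1 j2 R ∈ Γ → (Q : Fm (suc (suc m)) Δ) →
              Γ ⊢ substF Q (instσ₂ (con j1) (con j2)) → Γ ⊢ ∀' (∀' (Q ⇒ substF Q (succσ j1 j2))) →
              Γ ⊢ ∀' (∀' (sapp₂ R v1 v0 ⇒ Q))
R-induction {m} {Δ} {Γ} {j1} {j2} {R} least Q base step = cut base (cut (weaken₁ step) (∃²E (comp 2 ψ) body))
  where
    baseF stepF : Fm m Δ
    baseF = substF Q (instσ₂ (con j1) (con j2))
    stepF = ∀' (∀' (Q ⇒ substF Q (succσ j1 j2)))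
    Γ₁ : List (Fm m Δ)
    Γ₁ = stepF ∷ baseF ∷ Γ
    -- Comprehension binds its arguments in the opposite order, hence the swap.
    swap : Fin (suc (suc m)) → Tm (suc (suc m))
    swap = at₂σ v0 v1
    ψ : Fm (2 + m) Δ
    ψ = substF Q swap
    defZ : Fm m (2 ∷ Δ)
    defZ = ∀' (∀' (sapp₂ here v0 v1 ⇔ wkS ψ))
    Γ₂ : List (Fm m (2 ∷ Δ))
    Γ₂ = defZ ∷ List.map wkS Γ₁
    least₂ : Least j1 j2 (there R) ∈ Γ₂
    least₂ = there (∈-wkS {Γ = Γ₁} (there (there least)))
    base≡ : wkS baseF ≡ substF (wkS ψ) (instσ₂ (con j2) (con j1))
    base≡ = trans (renS-substF Q _ there)
              (sym (trans (cong (λ z → substF z _) (renS-substF Q swap there))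
                   (trans (substF-comp (wkS Q) swap _) (substF-cong (wkS Q) (λ { zero → refl ; (suc zero) → refl ; (suc (suc i)) → refl })))))
    Z-zero : Γ₂ ⊢ sapp₂ here (con j1) (con j2)
    Z-zero = ⇒E (∧E₂ (∀E₂ (assume (here refl)) (con j2) (con j1))) (cast base≡ (assume (there (∈-wkS {Γ = Γ₁} (there (here refl))))))
    ψ-at : ∀ t s → substF (substF (substF (wkS {j = 2} ψ) lift²wkσ) lift²wkσ) (instσ₂ t s) ≡ substF (wkS {j = 2} Q) (swap ⊙ at₂σ t s)
    ψ-at t s = trans (substF-lift²wkσ-inst (wkS ψ) t s)
               (trans (cong (λ z → substF z (at₂σ t s)) (renS-substF Q swap there)) (substF-comp (wkS Q) swap (at₂σ t s)))
    ψ-at-vars : substF (substF (substF (wkS ψ) lift²wkσ) lift²wkσ) (instσ₂ v0 v1) ≡ wkS Q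
    ψ-at-vars = trans (ψ-at v0 v1) (substF-id-pointwise (wkS Q) (λ { zero → refl ; (suc zero) → refl ; (suc (suc i)) → refl }))
    ψ-at-succ : substF (wkS Q) (succσ j1 j2) ≡ substF (substF (substF (wkS ψ) lift²wkσ) lift²wkσ) (instσ₂ (app j2 v0) (app j1 v1))
    ψ-at-succ = sym (trans (ψ-at _ _) (substF-cong (wkS Q) (λ { zero → refl ; (suc zero) → refl ; (suc (suc i)) → refl })))
    step≡ : substF (substF (substF (wkS (Q ⇒ substF Q (succσ j1 j2))) lift²wkσ) lift²wkσ) (instσ₂ v1 v0)
            ≡ (wkS Q ⇒ substF (wkS Q) (succσ j1 j2))
    step≡ = trans (substF-lift²wkσ-inst (wkS (Q ⇒ substF Q (succσ j1 j2))) v1 v0)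
              (cong₂ _⇒_ (substF-id-pointwise (wkS Q) (λ { zero → refl ; (suc zero) → refl ; (suc (suc i)) → refl }))
                         (trans (cong (λ z → substF z _) (renS-substF Q (succσ j1 j2) there))
                         (trans (substF-comp (wkS Q) _ _) (substF-cong (wkS Q) (λ { zero → refl ; (suc zero) → refl ; (suc (suc i)) → refl })))))
    Γ₃ : List (Fm (suc (suc m)) (2 ∷ Δ))
    Γ₃ = sapp₂ here v1 v0 ∷ List.map wkF (List.map wkF Γ₂)
    defZ₃ : Γ₃ ⊢ wkF (wkF defZ)
    defZ₃ = assume (there (∈-wkF² {Γ = Γ₂} (here refl)))
    step₃ : Γ₃ ⊢ wkF (wkF (wkS stepF))
    step₃ = assume (there (∈-wkF² {Γ = Γ₂} (there (∈-wkS {Γ = Γ₁} (here refl)))))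
    Z-succ : Γ₂ ⊢ RelSucc j1 j2 here
    Z-succ = ∀I (∀I (⇒I (⇒E (∧E₂ (∀E₂ defZ₃ (app j2 v0) (app j1 v1)))
                           (cast ψ-at-succ (⇒E (cast step≡ (∀E₂ step₃ v1 v0)) (cast ψ-at-vars (⇒E (∧E₁ (∀E₂ defZ₃ v0 v1)) assume₀)))))))
    R⊆Z : Fm m (2 ∷ Δ)
    R⊆Z = ∀' (∀' (sapp₂ (there R) v1 v0 ⇒ sapp₂ here v1 v0))
    body : Γ₂ ⊢ wkS (∀' (∀' (sapp₂ R v1 v0 ⇒ Q)))
    body = cut (⇒E (∀²E (assume least₂) here) (∧I Z-zero Z-succ))
             (∀I (∀I (⇒I (cast ψ-at-vars
               (⇒E (∧E₁ (∀E₂ (assume (there (∈-wkF² {Γ = R⊆Z ∷ Γ₂} (there (here refl))))) v0 v1))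
                   (⇒E (∀E₂ (assume (there (∈-wkF² {Γ = R⊆Z ∷ Γ₂} (here refl)))) v1 v0) assume₀))))))

-- The least relation is an isomorphism

InN : ∀ {n Δ} → Fin 2 → Fin 2 → SVar Δ 2 → Fm n Δ
InN j1 j2 R = ∀' (∀' (sapp₂ R v1 v0 ⇒ N j1 v1 ∧' N j2 v0))

ZeroInv : ∀ {n Δ} → Fin 2 → Fin 2 → SVar Δ 2 → Fm n Δ
ZeroInv j1 j2 R = ∀' (sapp₂ R (con j1) v0 ⇒ v0 ≐ con j2)

SuccInv : ∀ {n Δ} → Fin 2 → Fin 2 → SVar Δ 2 → Fm n Δ
SuccInv j1 j2 R = ∀' (N j1 v0 ⇒ ∀' (sapp₂ R (app j1 v1) v0 ⇒ ∃' (v1 ≐ app j2 v0 ∧' sapp₂ R v2 v0)))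

module _ {m Δ} {Γ : List (Fm m Δ)} {j1 j2 : Fin 2} {R : SVar Δ 2}
         (pa₁ : PArel j1 ∈ Γ) (pa₂ : PArel j2 ∈ Γ) (R-zero : RelZero j1 j2 R ∈ Γ) (R-succ : RelSucc j1 j2 R ∈ Γ)
         (least : Least j1 j2 R ∈ Γ) where

  least-InN : Γ ⊢ InN j1 j2 R
  least-InN = R-induction least (N j1 v1 ∧' N j2 v0) (∧I (zero∈N pa₁) (zero∈N pa₂))
                (∀I (∀I (⇒I (∧I (⇒E (∀E-substF (succ∈N (there (∈-wkF² pa₁))) v1) (∧E₁ assume₀))
                                (⇒E (∀E-substF (succ∈N (there (∈-wkF² pa₂))) v0) (∧E₂ assume₀))))))

  least-domain : Γ ⊢ DomainIn j1 R
  least-domain = cut least-InN (∀I (∀I (⇒I (∧E₁ (⇒E (∀E₂ (assume (there (∈-wkF² {Γ = InN j1 j2 R ∷ Γ} (here refl)))) v1 v0)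
                                                    assume₀)))))

  least-total : ∀ {R'} → ConverseIn R R' ∈ Γ → Γ ⊢ Total j1 j2 R R'
  least-total {R'} converse = cut defined (∀I (⇒I (∃E (⇒E (∀E-substF (assume (there (∈-wkF {Γ = definedF ∷ Γ} (here refl)))) v0) assume₀)
      (∃I v0 (∧I (∧E₁ assume₀) (∧I (∧E₂ assume₀)
        (⇒E (∀E₂ (assume (there (∈-wkF {Γ = Γ'} (there (∈-wkF {Γ = definedF ∷ Γ} (there converse)))))) v1 v0) (∧E₂ assume₀))))))))
    where
      image : Fm (suc m) Δ
      image = ∃' (N j2 v0 ∧' sapp₂ R v1 v0)
      definedF : Fm m Δ
      definedF = ∀' (N j1 v0 ⇒ image)
      Γ' : List (Fm (suc m) Δ)
      Γ' = N j1 v0 ∷ List.map wkF (definedF ∷ Γ)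
      Γs : List (Fm (suc m) Δ)
      Γs = image ∷ N j1 v0 ∷ List.map wkF Γ
      defined : Γ ⊢ definedF
      defined = N-induction pa₁ image (∃I (con j2) (∧I (zero∈N pa₂) (assume R-zero)))
        (∀I (⇒I (⇒I (∃E assume₀
          (∃I (app j2 v0) (∧I (⇒E (∀E-substF (succ∈N (there (∈-wkF {Γ = Γs} (there (there (∈-wkF pa₂)))))) v0) (∧E₁ assume₀))
                              (⇒E (∀E₂ (assume (there (∈-wkF {Γ = Γs} (there (there (∈-wkF R-succ)))))) v1 v0) (∧E₂ assume₀))))))))

  least-ZeroInv : Γ ⊢ ZeroInv j1 j2 R
  least-ZeroInv = cut least-InN (cut zero-inv-all
      (∀I (⇒I (⇒E (∧E₂ (⇒E (∀E₂ (assume (there (∈-wkF {Γ = zero-inv-allF ∷ Γ'} (here refl)))) (con j1) v0) assume₀))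
                  (≐refl (con j1))))))
    where
      Q : Fm (suc (suc m)) Δ
      Q = sapp₂ R v1 v0 ∧' (v1 ≐ con j1 ⇒ v0 ≐ con j2)
      Γ' : List (Fm m Δ)
      Γ' = InN j1 j2 R ∷ Γ
      Γ₃ : List (Fm (suc (suc m)) Δ)
      Γ₃ = (app j1 v1 ≐ con j1) ∷ Q ∷ List.map wkF (List.map wkF Γ')
      x∈N : Γ₃ ⊢ N j1 v1
      x∈N = ∧E₁ (⇒E (∀E₂ (assume (there (there (∈-wkF² {Γ = Γ'} (here refl))))) v1 v0) (∧E₁ (assume (there (here refl)))))
      step : Γ' ⊢ ∀' (∀' (Q ⇒ substF Q (succσ j1 j2)))
      step = ∀I (∀I (⇒I (∧I (⇒E (∀E₂ (assume (there (∈-wkF² {Γ = Γ'} (there R-succ)))) v1 v0) (∧E₁ assume₀))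
                            (⇒I (⊥E (⇒E (⇒E (∀E-substF (succ≢zero (there (there (∈-wkF² {Γ = Γ'} (there pa₁))))) v1) x∈N) assume₀))))))
      zero-inv-allF : Fm m Δ
      zero-inv-allF = ∀' (∀' (sapp₂ R v1 v0 ⇒ Q))
      zero-inv-all : Γ' ⊢ zero-inv-allF
      zero-inv-all = R-induction (there least) Q (∧I (assume (there R-zero)) (⇒I (≐refl (con j2)))) step

  least-SuccInv : Γ ⊢ SuccInv j1 j2 R
  least-SuccInv = cut least-InN (∀I (⇒I (cut succ-inv-all (∀I (⇒I
      (⇒E (∧E₂ (⇒E (∀E₂ (assume (there (∈-wkF {Γ = succ-inv-allF ∷ Γx} (here refl)))) (app j1 v1) v0) assume₀))
          (≐refl (app j1 v1))))))))
    where
      Γ' : List (Fm m Δ)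
      Γ' = InN j1 j2 R ∷ Γ
      Γx : List (Fm (suc m) Δ)
      Γx = N j1 v0 ∷ List.map wkF Γ'
      -- Q u y : R u y ∧ (u = S x → ∃z (y = S z ∧ R x z)), with x the outer variable
      Q : Fm (suc (suc (suc m))) Δ
      Q = sapp₂ R v1 v0 ∧' (v1 ≐ app j1 v2 ⇒ ∃' (v1 ≐ app j2 v0 ∧' sapp₂ R (var (suc (suc (suc zero)))) v0))
      base : Γx ⊢ substF Q (instσ₂ (con j1) (con j2))
      base = ∧I (assume (there (∈-wkF {Γ = Γ'} (there R-zero))))
                (⇒I (⊥E (⇒E (⇒E (∀E-substF (succ≢zero (there (there (∈-wkF {Γ = Γ'} (there pa₁))))) v0) (assume (there (here refl))))
                             (≐sym assume₀))))
      Γ₆ : List (Fm (suc (suc (suc m))) Δ)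
      Γ₆ = (app j1 v1 ≐ app j1 v2) ∷ Q ∷ List.map wkF (List.map wkF Γx)
      u∈N : Γ₆ ⊢ N j1 v1
      u∈N = ∧E₁ (⇒E (∀E₂ (assume (there (there (∈-wkF² {Γ = Γx} (there (∈-wkF {Γ = Γ'} (here refl))))))) v1 v0)
                      (∧E₁ (assume (there (here refl)))))
      x∈N : Γ₆ ⊢ N j1 v2
      x∈N = assume (there (there (∈-wkF² {Γ = Γx} (here refl))))
      u≐x : Γ₆ ⊢ v1 ≐ v2
      u≐x = ⇒E (⇒E (∀E-substF (⇒E (∀E-substF (succ-injective (there (there (∈-wkF² {Γ = Γx} (there (∈-wkF {Γ = Γ'} (there pa₁))))))) v1) u∈N) v2)
                    x∈N)
               assume₀
      step : Γx ⊢ ∀' (∀' (Q ⇒ substF Q (succσ j1 j2)))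
      step = ∀I (∀I (⇒I (∧I (⇒E (∀E₂ (assume (there (∈-wkF² {Γ = Γx} (there (∈-wkF {Γ = Γ'} (there R-succ)))))) v1 v0) (∧E₁ assume₀))
                            (⇒I (∃I v0 (∧I (≐refl (app j2 v0)) (≐subst-sapp₂ˡ R v0 u≐x (∧E₁ (assume (there (here refl)))))))))))
      succ-inv-allF : Fm (suc m) Δ
      succ-inv-allF = ∀' (∀' (sapp₂ R v1 v0 ⇒ Q))
      succ-inv-all : Γx ⊢ succ-inv-allF
      succ-inv-all = R-induction (there (∈-wkF {Γ = Γ'} (there least))) Q base step

  -- By induction on x ∈ N_j1: R x y and R x y' imply y = y'.
  least-functional : Γ ⊢ Functional R
  least-functional = cut least-InN (cut (weaken₁ least-ZeroInv) (cut (weaken₁ (weaken₁ least-SuccInv))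
      (cut functional-on-N (∀I (∀I (∀I (⇒I (⇒I
        (⇒E (⇒E (∀E₂ (⇒E (∀E-substF (assume (there (there (∈-wkF³ {Γ = ΓN} (here refl))))) v2) x∈N) v1 v0)
                (assume (there (here refl))))
            assume₀)))))))))
    where
      Γ' : List (Fm m Δ)
      Γ' = SuccInv j1 j2 R ∷ ZeroInv j1 j2 R ∷ InN j1 j2 R ∷ Γ
      P : Fm (suc m) Δ
      P = ∀' (∀' (sapp₂ R v2 v1 ⇒ sapp₂ R v2 v0 ⇒ v1 ≐ v0))
      ΓN : List (Fm m Δ)
      ΓN = ∀' (N j1 v0 ⇒ P) ∷ Γ'
      x∈N : (sapp₂ R v2 v0 ∷ sapp₂ R v2 v1 ∷ List.map wkF (List.map wkF (List.map wkF ΓN))) ⊢ N j1 v2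
      x∈N = ∧E₁ (⇒E (∀E₂ (assume (there (there (∈-wkF³ {Γ = ΓN} (there (there (there (here refl)))))))) v2 v1)
                    (assume (there (here refl))))
      Γb : List (Fm (suc (suc m)) Δ)
      Γb = sapp₂ R (con j1) v0 ∷ sapp₂ R (con j1) v1 ∷ List.map wkF (List.map wkF Γ')
      zero-inv : ZeroInv j1 j2 R ∈ Γb
      zero-inv = there (there (∈-wkF² {Γ = Γ'} (there (here refl))))
      base : Γ' ⊢ substF P (instσ (con j1))
      base = ∀I (∀I (⇒I (⇒I (≐trans (⇒E (∀E-substF (assume zero-inv) v1) (assume (there (here refl))))
                                     (≐sym (⇒E (∀E-substF (assume zero-inv) v0) assume₀))))))
      Γs : List (Fm (suc m) Δ)
      Γs = P ∷ N j1 v0 ∷ List.map wkF Γ'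
      -- Γt: R (S x) y, R (S x) y'; unpacking SuccInv twice gives y = S z, y' = S z' with R x z, R x z'.
      Γt : List (Fm (suc (suc (suc m))) Δ)
      Γt = sapp₂ R (app j1 v2) v0 ∷ sapp₂ R (app j1 v2) v1 ∷ List.map wkF (List.map wkF Γs)
      succ-inv : SuccInv j1 j2 R ∈ Γt
      succ-inv = there (there (∈-wkF² {Γ = Γs} (there (there (∈-wkF {Γ = Γ'} (here refl))))))
      x∈Nt : N j1 v2 ∈ Γt
      x∈Nt = there (there (∈-wkF² {Γ = Γs} (there (here refl))))
      pred₁ : Fm (suc (suc (suc (suc m)))) Δ
      pred₁ = v2 ≐ app j2 v0 ∧' sapp₂ R (var (suc (suc (suc zero)))) v0
      Γu : List (Fm (suc (suc (suc (suc m)))) Δ)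
      Γu = pred₁ ∷ List.map wkF Γt
      Γv : List (Fm (suc (suc (suc (suc (suc m))))) Δ)
      Γv = (v2 ≐ app j2 v0 ∧' sapp₂ R (var (suc (suc (suc (suc zero))))) v0) ∷ List.map wkF Γu
      pred₁v : Γv ⊢ wkF pred₁
      pred₁v = assume (there (∈-wkF {Γ = Γu} (here refl)))
      ih : wkF (wkF (wkF (wkF P))) ∈ Γv
      ih = there (∈-wkF {Γ = Γu} (there (∈-wkF {Γ = Γt} (there (there (∈-wkF² {Γ = Γs} (here refl)))))))
      z≐z' : Γv ⊢ v1 ≐ v0
      z≐z' = ⇒E (⇒E (∀E₂ (assume ih) v1 v0) (∧E₂ pred₁v)) (∧E₂ assume₀)
      y≐y'ᵥ : Γv ⊢ var (suc (suc (suc zero))) ≐ v2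
      y≐y'ᵥ = ≐trans (∧E₁ pred₁v) (≐trans (≐cong j2 z≐z') (≐sym (∧E₁ assume₀)))
      y≐y'ᵤ : Γu ⊢ v2 ≐ v1
      y≐y'ᵤ = ∃E (⇒E (∀E-substF (⇒E (∀E-substF (assume (there (∈-wkF {Γ = Γt} succ-inv))) (var (suc (suc (suc zero)))))
                                     (assume (there (∈-wkF {Γ = Γt} x∈Nt)))) v1)
                     (assume (there (∈-wkF {Γ = Γt} (here refl)))))
                 y≐y'ᵥ
      y≐y' : Γt ⊢ v1 ≐ v0
      y≐y' = ∃E (⇒E (∀E-substF (⇒E (∀E-substF (assume succ-inv) v2) (assume x∈Nt)) v1) (assume (there (here refl)))) y≐y'ᵤ
      functional-on-N : Γ' ⊢ ∀' (N j1 v0 ⇒ P)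
      functional-on-N = N-induction (there (there (there pa₁))) P base (∀I (⇒I (⇒I (∀I (∀I (⇒I (⇒I y≐y')))))))

-- R x y :⇔ every Z containing (0_j1, 0_j2) and closed under successors contains (x, y).
least-relation-exists : ∀ {m Δ} {Γ : List (Fm m Δ)} (j1 j2 : Fin 2) {C : Fm m Δ} →
                        (RelZero j1 j2 here ∷ RelSucc j1 j2 here ∷ Least j1 j2 here ∷ List.map wkS Γ) ⊢ wkS C → Γ ⊢ C
least-relation-exists {m} {Δ} {Γ} j1 j2 cont =
  ∃²E (comp 2 ψ) (cut R-least (cut (weaken₁ R-succ) (cut (weaken₁ (weaken₁ R-zero))
    (weaken (++⁺ʳ (_ ∷ _ ∷ _ ∷ []) (xs⊆x∷xs _ defR)) cont))))
  where
    closed : ∀ {n Δ'} → Fm n (2 ∷ Δ')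
    closed = RelZero j1 j2 here ∧' RelSucc j1 j2 here
    ψ : Fm (2 + m) Δ
    ψ = ∀² 2 (closed ⇒ sapp₂ here v0 v1)
    defR : Fm m (2 ∷ Δ)
    defR = ∀' (∀' (sapp₂ here v0 v1 ⇔ wkS ψ))
    Γ₁ : List (Fm m (2 ∷ Δ))
    Γ₁ = defR ∷ List.map wkS Γ
    R-zero : Γ₁ ⊢ RelZero j1 j2 here
    R-zero = ⇒E (∧E₂ (∀E₂ (assume (here refl)) (con j2) (con j1))) (∀²I (⇒I (∧E₁ assume₀)))
    R-succ : Γ₁ ⊢ RelSucc j1 j2 here
    R-succ = ∀I (∀I (⇒I (cut every-Z (⇒E (∧E₂ (∀E₂ (assume (there (there (∈-wkF² {Γ = Γ₁} (here refl))))) (app j2 v0) (app j1 v1)))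
                     (∀²I (⇒I (⇒E (∀E₂ (∧E₂ assume₀) v1 v0)
                                  (⇒E (∀²E (assume (there (∈-wkS {Γ = everyZF ∷ Γc} (here refl)))) here) assume₀))))))))
      where
        Γc : List (Fm (suc (suc m)) (2 ∷ Δ))
        Γc = sapp₂ here v1 v0 ∷ List.map wkF (List.map wkF Γ₁)
        everyZF : Fm (suc (suc m)) (2 ∷ Δ)
        everyZF = ∀² 2 (closed ⇒ sapp₂ here v1 v0)
        every-Z : Γc ⊢ everyZF
        every-Z = ⇒E (∧E₁ (∀E₂ (assume (there (∈-wkF² {Γ = Γ₁} (here refl)))) v0 v1)) assume₀
    R-least : Γ₁ ⊢ Least j1 j2 here
    R-least = ∀²I (⇒I (∀I (∀I (⇒I (⇒E (∀²E every-Z here) (assume (there (∈-wkF² {Γ = Γb} (here refl)))))))))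
      where
        Γb : List (Fm m (2 ∷ 2 ∷ Δ))
        Γb = closed ∷ List.map wkS Γ₁
        Γi : List (Fm (suc (suc m)) (2 ∷ 2 ∷ Δ))
        Γi = sapp₂ (there here) v1 v0 ∷ List.map wkF (List.map wkF Γb)
        every-Z : Γi ⊢ ∀² 2 (closed ⇒ sapp₂ here v1 v0)
        every-Z = ⇒E (∧E₁ (∀E₂ (assume (there (∈-wkF² {Γ = Γb} (there (∈-wkS {Γ = Γ₁} (here refl)))))) v0 v1)) assume₀

module _ {m Δ} {Γ : List (Fm m Δ)} {j1 j2 : Fin 2} {R R' : SVar Δ 2} where

  converse-zero : RelZero j1 j2 R ∈ Γ → ConverseIn R R' ∈ Γ → Γ ⊢ RelZero j2 j1 R'
  converse-zero R-zero conv = ⇒E (∀E₂ (assume conv) (con j1) (con j2)) (assume R-zero)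

  converse-succ : RelSucc j1 j2 R ∈ Γ → ConverseIn R R' ∈ Γ → ConverseIn R' R ∈ Γ → Γ ⊢ RelSucc j2 j1 R'
  converse-succ R-succ conv conv⁻ =
    ∀I (∀I (⇒I (⇒E (∀E₂ (assume (there (∈-wkF² conv))) (app j1 v0) (app j2 v1))
                   (⇒E (∀E₂ (assume (there (∈-wkF² R-succ))) v0 v1)
                       (⇒E (∀E₂ (assume (there (∈-wkF² conv⁻))) v1 v0) assume₀)))))

  -- Given Z closed for (j2, j1), its transpose Z' is closed for (j1, j2), so R ⊆ Z' and hence R' ⊆ Z.
  converse-least : Least j1 j2 R ∈ Γ → ConverseIn R' R ∈ Γ → Γ ⊢ Least j2 j1 R'
  converse-least least conv⁻ = ∀²I (⇒I (∃²E (comp 2 (sapp₂ here v1 v0)) R'⊆Z))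
    where
      closedZ : Fm m (2 ∷ Δ)
      closedZ = RelZero j2 j1 here ∧' RelSucc j2 j1 here
      Γb : List (Fm m (2 ∷ Δ))
      Γb = closedZ ∷ List.map wkS Γ
      defZ' : Fm m (2 ∷ 2 ∷ Δ)
      defZ' = ∀' (∀' (sapp₂ here v0 v1 ⇔ sapp₂ (there here) v1 v0))
      Γc : List (Fm m (2 ∷ 2 ∷ Δ))
      Γc = defZ' ∷ List.map wkS Γb
      Z-closed : RelZero j2 j1 (there here) ∧' RelSucc j2 j1 (there here) ∈ Γc
      Z-closed = there (∈-wkS {Γ = Γb} (here refl))
      Z'-zero : Γc ⊢ sapp₂ here (con j1) (con j2)
      Z'-zero = ⇒E (∧E₂ (∀E₂ (assume (here refl)) (con j2) (con j1))) (∧E₁ (assume Z-closed))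
      Γq : List (Fm (suc (suc m)) (2 ∷ 2 ∷ Δ))
      Γq = sapp₂ here v1 v0 ∷ List.map wkF (List.map wkF Γc)
      defZ'q : Γq ⊢ wkF (wkF defZ')
      defZ'q = assume (there (∈-wkF² {Γ = Γc} (here refl)))
      Z'-succ : Γc ⊢ RelSucc j1 j2 here
      Z'-succ = ∀I (∀I (⇒I (⇒E (∧E₂ (∀E₂ defZ'q (app j2 v0) (app j1 v1)))
                              (⇒E (∀E₂ (∧E₂ (assume (there (∈-wkF² {Γ = Γc} Z-closed)))) v0 v1)
                                  (⇒E (∧E₁ (∀E₂ defZ'q v0 v1)) assume₀)))))
      R⊆Z'F : Fm m (2 ∷ 2 ∷ Δ)
      R⊆Z'F = ∀' (∀' (sapp₂ (there (there R)) v1 v0 ⇒ sapp₂ here v1 v0))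
      R⊆Z' : Γc ⊢ R⊆Z'F
      R⊆Z' = ⇒E (∀²E (assume (there (∈-wkS {Γ = Γb} (there (∈-wkS least))))) here) (∧I Z'-zero Z'-succ)
      lift : ∀ {φ} → φ ∈ Γc → wkF (wkF φ) ∈ (sapp₂ (there (there R')) v1 v0 ∷ List.map wkF (List.map wkF (R⊆Z'F ∷ Γc)))
      lift p = there (∈-wkF² {Γ = R⊆Z'F ∷ Γc} (there p))
      R'⊆Z : Γc ⊢ wkS (∀' (∀' (sapp₂ (there R') v1 v0 ⇒ sapp₂ here v1 v0)))
      R'⊆Z = cut R⊆Z' (∀I (∀I (⇒I
        (⇒E (∧E₁ (∀E₂ (assume (lift (here refl))) v1 v0))
            (⇒E (∀E₂ (assume (there (∈-wkF² {Γ = R⊆Z'F ∷ Γc} (here refl)))) v0 v1)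
                (⇒E (∀E₂ (assume (lift (there (∈-wkS {Γ = Γb} (there (∈-wkS conv⁻)))))) v1 v0) assume₀))))))

converse-exists : ∀ {m Δ} {Γ : List (Fm m Δ)} {j1 j2 : Fin 2} {R : SVar Δ 2} {C : Fm m Δ} →
                  RelZero j1 j2 R ∈ Γ → RelSucc j1 j2 R ∈ Γ → Least j1 j2 R ∈ Γ →
                  (Least j2 j1 here ∷ RelSucc j2 j1 here ∷ RelZero j2 j1 here
                     ∷ ConverseIn here (there R) ∷ ConverseIn (there R) here ∷ List.map wkS Γ) ⊢ wkS C →
                  Γ ⊢ C
converse-exists {m} {Δ} {Γ} {j1} {j2} {R} R-zero R-succ least cont =
  ∃²E (comp 2 (sapp₂ R v1 v0))
    (cut conv (cut conv⁻
      (cut (converse-zero (lift R-zero) (there (here refl)))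
      (cut (weaken₁ (converse-succ (lift R-succ) (there (here refl)) (here refl)))
      (cut (weaken₁ (weaken₁ (converse-least (lift least) (here refl))))
      (weaken (++⁺ʳ (_ ∷ _ ∷ _ ∷ _ ∷ _ ∷ []) (xs⊆x∷xs _ defR')) cont))))))
  where
    defR' : Fm m (2 ∷ Δ)
    defR' = ∀' (∀' (sapp₂ here v0 v1 ⇔ sapp₂ (there R) v1 v0))
    Γ₂ : List (Fm m (2 ∷ Δ))
    Γ₂ = defR' ∷ List.map wkS Γ
    lift : ∀ {φ} → φ ∈ Γ → wkS φ ∈ (ConverseIn here (there R) ∷ ConverseIn (there R) here ∷ Γ₂)
    lift p = there (there (there (∈-wkS p)))
    conv : Γ₂ ⊢ ConverseIn (there R) here
    conv = ∀I (∀I (⇒I (⇒E (∧E₂ (∀E₂ (assume (there (∈-wkF² {Γ = Γ₂} (here refl)))) v1 v0)) assume₀)))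
    conv⁻ : (ConverseIn (there R) here ∷ Γ₂) ⊢ ConverseIn here (there R)
    conv⁻ = ∀I (∀I (⇒I (⇒E (∧E₁ (∀E₂ (assume (there (∈-wkF² {Γ = ConverseIn (there R) here ∷ Γ₂} (there (here refl))))) v0 v1)) assume₀)))

iso-exists : ∀ {m Δ} {Γ : List (Fm m Δ)} {j1 j2 : Fin 2} {C : Fm m Δ} → PArel j1 ∈ Γ → PArel j2 ∈ Γ →
             (∀ {Γ'} → (∀ {φ} → φ ∈ Γ → wkS {j = 2} (wkS {j = 2} φ) ∈ Γ') → IsoFacts Γ' j1 j2 (there here) here →
                Γ' ⊢ wkS (wkS C)) →
             Γ ⊢ C
iso-exists {m} {Δ} {Γ} {j1} {j2} pa₁ pa₂ cont =
  least-relation-exists j1 j2 (converse-exists (here refl) (there (here refl)) (there (there (here refl)))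
    (cut R-total (cut (weaken₁ R-functional) (cut (weaken₁ (weaken₁ R-domain))
      (cut (weaken₁ (weaken₁ (weaken₁ R'-total))) (cut (weaken₁ (weaken₁ (weaken₁ (weaken₁ R'-functional))))
        (cut (weaken₁ (weaken₁ (weaken₁ (weaken₁ (weaken₁ R'-domain))))) (cont (there⁶ ∘ lift₀) facts))))))))
  where
    R R' : SVar (2 ∷ 2 ∷ Δ) 2
    R = there here
    R' = here
    Γ₁ : List (Fm m (2 ∷ Δ))
    Γ₁ = RelZero j1 j2 here ∷ RelSucc j1 j2 here ∷ Least j1 j2 here ∷ List.map wkS Γ
    Γ₂ : List (Fm m (2 ∷ 2 ∷ Δ))
    Γ₂ = Least j2 j1 R' ∷ RelSucc j2 j1 R' ∷ RelZero j2 j1 R' ∷ ConverseIn R' R ∷ ConverseIn R R' ∷ List.map wkS Γ₁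
    lift₁ : ∀ {φ} → φ ∈ Γ₁ → wkS φ ∈ Γ₂
    lift₁ p = there (there (there (there (there (∈-wkS p)))))
    lift₀ : ∀ {φ} → φ ∈ Γ → wkS (wkS φ) ∈ Γ₂
    lift₀ p = lift₁ (there (there (there (∈-wkS p))))
    R-zero : RelZero j1 j2 R ∈ Γ₂
    R-zero = lift₁ (here refl)
    R-succ : RelSucc j1 j2 R ∈ Γ₂
    R-succ = lift₁ (there (here refl))
    R-least : Least j1 j2 R ∈ Γ₂
    R-least = lift₁ (there (there (here refl)))
    R'-least : Least j2 j1 R' ∈ Γ₂
    R'-least = here refl
    R'-succ : RelSucc j2 j1 R' ∈ Γ₂
    R'-succ = there (here refl)
    R'-zero : RelZero j2 j1 R' ∈ Γ₂
    R'-zero = there (there (here refl))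
    R'-conv : ConverseIn R' R ∈ Γ₂
    R'-conv = there (there (there (here refl)))
    R-conv : ConverseIn R R' ∈ Γ₂
    R-conv = there (there (there (there (here refl))))
    R-total : Γ₂ ⊢ Total j1 j2 R R'
    R-total = least-total (lift₀ pa₁) (lift₀ pa₂) R-zero R-succ R-least R-conv
    R-functional : Γ₂ ⊢ Functional R
    R-functional = least-functional (lift₀ pa₁) (lift₀ pa₂) R-zero R-succ R-least
    R-domain : Γ₂ ⊢ DomainIn j1 R
    R-domain = least-domain (lift₀ pa₁) (lift₀ pa₂) R-zero R-succ R-least
    R'-total : Γ₂ ⊢ Total j2 j1 R' R
    R'-total = least-total (lift₀ pa₂) (lift₀ pa₁) R'-zero R'-succ R'-least R'-conv
    R'-functional : Γ₂ ⊢ Functional R'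
    R'-functional = least-functional (lift₀ pa₂) (lift₀ pa₁) R'-zero R'-succ R'-least
    R'-domain : Γ₂ ⊢ DomainIn j2 R'
    R'-domain = least-domain (lift₀ pa₂) (lift₀ pa₁) R'-zero R'-succ R'-least
    Γ₃ : List (Fm m (2 ∷ 2 ∷ Δ))
    Γ₃ = DomainIn j2 R' ∷ Functional R' ∷ Total j2 j1 R' R ∷ DomainIn j1 R ∷ Functional R ∷ Total j1 j2 R R' ∷ Γ₂
    there⁶ : ∀ {φ} → φ ∈ Γ₂ → φ ∈ Γ₃
    there⁶ p = there (there (there (there (there (there p)))))
    facts : IsoFacts Γ₃ j1 j2 R R'
    facts = record
      { rel-zero = there⁶ R-zero ; rel-succ = there⁶ R-succ ; total = there (there (there (there (there (here refl)))))
      ; functional = there (there (there (there (here refl)))) ; domain = there (there (there (here refl)))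
      ; converse = there⁶ R-conv
      ; rel-zero⁻ = there⁶ R'-zero ; rel-succ⁻ = there⁶ R'-succ ; total⁻ = there (there (here refl))
      ; functional⁻ = there (here refl) ; domain⁻ = here refl ; converse⁻ = there⁶ R'-conv }

noVars : Fin 0 → Tm 0
noVars ()

noRels : ∀ {Δ} → Ren [] Δ
noRels ()

Related-sentence : ∀ {Δ} {Γ : List (Fm 0 Δ)} {j1 j2 R R'} → IsoFacts Γ j1 j2 R R' →
                   Related Γ j1 j2 R R' noVars noVars noRels noRels
Related-sentence F = record { isoFacts = F ; terms = λ () ; terms⁻ = λ () ; rels = λ () ; rels⁻ = λ () }

relativize-sentence : ∀ {k k'} j (φ : Formula Arith 0 []) →
                      relativize j noVars noRels φ ≡ wkS {j = k} (wkS {j = k'} (relF j φ))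
relativize-sentence j φ =
  trans (cong (λ z → renS z noRels) (substF-id-pointwise (relF j φ) (λ ())))
        (sym (trans (renS-comp (relF j φ) there there) (renS-cong (relF j φ) (λ ()))))

corollary3 : (φ : Formula Arith 0 []) →
    Inconsistent (PA2rel zero ∷ PA2rel (suc zero) ∷ relF zero φ ∷ ¬' (relF (suc zero) φ) ∷ [])
corollary3 φ = iso-exists (here refl) (there (here refl)) λ lift F →
  ⇒E (assume (lift (there (there (there (here refl))))))
     (cast (relativize-sentence (suc zero) φ)
           (⇒E (transfer φ (Related-sentence F))
               (cast (sym (relativize-sentence zero φ)) (assume (lift (there (there (here refl))))))))
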